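{- Let $G$ be a cyclic group of order $2^n$ with $n\ge1$, and let $\tau$ be the unique element of $G$ of order $2$. Let $R$ be a commutative ring with unit equipped with a ring homomorphism $\mathbb{Z}[\zeta_{2^n}]\to R$, and let $M$ be a finite $R[G]$-module such that $M^{+}:=\{m\in M:\tau m=m\}$ equals $(1+\tau)M$. Then $$[M]=\prod_{\psi\in\widehat{G}}[M^{\psi}]=\prod_{\psi\in\widehat{G}}[\varepsilon_\psi M].$$
   Context: $[X]$ is the order of a finite set $X$; $\zeta_{2^n}$ is a primitive complex $2^n$-th root of unity. $\widehat G$ is the set of the $2^n$ homomorphisms $G\to\mu_{2^n}\subset\mathbb{Z}[\zeta_{2^n}]^\times$, regarded as $R$-valued via the fixed homomorphism; products are indexed by these characters. For $\psi\in\widehat G$: $M^\psi=\{m\in M:\sigma m=\psi(\sigma)m\ \forall\sigma\in G\}$ and $\varepsilon_\psi=\sum_{\sigma\in G}\psi(\sigma)^{ -1}\sigma\in R[G]$. -}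

module Defs where

open import Level using (Level; _⊔_)
open import Algebra.Bundles using (CommutativeRing)
open import Algebra.Module.Bundles using (Module)
open import Data.Nat using (ℕ; zero; suc; _^_; _∸_; _≤_) renaming (_*_ to _*ℕ_)
open import Data.Fin using (Fin; toℕ)
open import Data.Fin.Properties using (all?)
open import Data.List using (List; []; _∷_; length; filter; map; foldr; allFin)
open import Data.Nat.ListAction using (product)
open import Data.List.Relation.Unary.Any using (Any; any?)
open import Data.List.Relation.Unary.AllPairs using (AllPairs)
open import Data.Product using (Σ; _×_)
open import Relation.Nullary using (Dec; ¬_)
open import Relation.Unary using (Pred; Decidable)

iter : ∀ {a} {A : Set a} → ℕ → (A → A) → A → A
iter zero    f x = x
iter (suc k) f x = f (iter k f x)

module _ {r ℓr : Level} (R : CommutativeRing r ℓr) where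
  open CommutativeRing R

  pow : Carrier → ℕ → Carrier
  pow x zero    = 1#
  pow x (suc k) = x * pow x k

  -- A ring homomorphism Z[ζ_{2^n}] → R.  Since
  -- Z[ζ_{2^n}] = Z[x]/(Φ_{2^n}(x)) with Φ_{2^n}(x) = x^{2^{n-1}} + 1 (n ≥ 1),
  -- such a homomorphism is (by the universal property of this quotient) the
  -- same thing as the image ζ ∈ R of ζ_{2^n}, subject to ζ^{2^{n-1}} + 1 = 0.
  record ZetaHom (n : ℕ) : Set (r ⊔ ℓr) where
    field
      ζ            : Carrier
      cyclotomic   : pow ζ (2 ^ (n ∸ 1)) + 1# ≈ 0#

  -- An R[G]-module, G cyclic of order 2^n with fixed generator σ
  -- (G = {σ^k : k < 2^n}): an R-module with an R-linear endomorphism σ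
  -- such that σ^{2^n} = id.
  record RGModule (n : ℕ) (m ℓm : Level) : Set (r ⊔ ℓr ⊔ Level.suc (m ⊔ ℓm)) where
    field
      M : Module R m ℓm
    open Module M public
    field
      σ       : Carrierᴹ → Carrierᴹ
      σ-cong  : ∀ {x y} → x ≈ᴹ y → σ x ≈ᴹ σ y
      σ-+     : ∀ x y → σ (x +ᴹ y) ≈ᴹ (σ x +ᴹ σ y)
      σ-*ₗ    : ∀ a x → σ (a *ₗ x) ≈ᴹ (a *ₗ σ x)
      σ-order : ∀ x → iter (2 ^ n) σ x ≈ᴹ x

    act : Fin (2 ^ n) → Carrierᴹ → Carrierᴹ
    act k = iter (toℕ k) σ

    τ : Carrierᴹ → Carrierᴹ
    τ = iter (2 ^ (n ∸ 1)) σ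

  record FiniteRGModule {n : ℕ} {m ℓm : Level} (A : RGModule n m ℓm) : Set (m ⊔ ℓm) where
    open RGModule A
    field
      _≟ᴹ_     : ∀ x y → Dec (x ≈ᴹ y)
      elems    : List Carrierᴹ
      complete : ∀ x → Any (x ≈ᴹ_) elems
      distinct : AllPairs (λ x y → ¬ (x ≈ᴹ y)) elems

    card : ∀ {p} {P : Pred Carrierᴹ p} → Decidable P → ℕ
    card P? = length (filter P? elems)

    InImage : (Carrierᴹ → Carrierᴹ) → Pred Carrierᴹ (m ⊔ ℓm)
    InImage f x = Any (λ y → x ≈ᴹ f y) elems

    inImage? : (f : Carrierᴹ → Carrierᴹ) → Decidable (InImage f)
    inImage? f x = any? (λ y → x ≟ᴹ f y) elems

  module _ {n : ℕ} {m ℓm : Level} (Z : ZetaHom n) (A : RGModule n m ℓm) where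
    open ZetaHom Z
    open RGModule A

    ψ : Fin (2 ^ n) → Fin (2 ^ n) → Carrier
    ψ j k = pow ζ (toℕ j *ℕ toℕ k)

    ψ⁻¹ : Fin (2 ^ n) → Fin (2 ^ n) → Carrier
    ψ⁻¹ j k = pow ζ (toℕ j *ℕ (2 ^ n ∸ toℕ k))

    InEigen : Fin (2 ^ n) → Pred Carrierᴹ ℓm
    InEigen j x = ∀ k → act k x ≈ᴹ (ψ j k *ₗ x)

    ε : Fin (2 ^ n) → Carrierᴹ → Carrierᴹ
    ε j x = foldr (λ k acc → (ψ⁻¹ j k *ₗ act k x) +ᴹ acc) 0ᴹ (allFin (2 ^ n))

    PlusCondition : Set (m ⊔ ℓm)
    PlusCondition = ∀ x → ((τ x ≈ᴹ x) → Σ Carrierᴹ (λ y → x ≈ᴹ (y +ᴹ τ y)))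
                        × (Σ Carrierᴹ (λ y → x ≈ᴹ (y +ᴹ τ y)) → τ x ≈ᴹ x)

    module _ (F : FiniteRGModule A) where
      open FiniteRGModule F

      inEigen? : ∀ j → Decidable (InEigen j)
      inEigen? j x = all? (λ k → act k x ≟ᴹ (ψ j k *ₗ x))

      cardM : ℕ
      cardM = length elems

      prodEigen : ℕ
      prodEigen = product (map (λ j → card (inEigen? j)) (allFin (2 ^ n)))

      prodEpsImage : ℕ
      prodEpsImage = product (map (λ j → card (inImage? (ε j))) (allFin (2 ^ n)))

-- Write ζ for the image of ζ_{2^n}, ω = ζ⁻¹, and T_{b,e} = ω^{e·2^b} σ^{2^b} for b ≤ n, so that
-- M^{ψ_e} = Fix T_{0,e}, ε_{ψ_e} is the norm of T_{0,e}, T_{n-1,e} = ±τ and T_{n,0} = 1.  Say that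
-- Ĥ⁰ (resp. Ĥ⁻¹) vanishes for T when every T-fixed point is a norm (resp. every element of norm 0
-- lies in (1 − T)M).  The hypothesis M⁺ = (1 + τ)M says that Ĥ⁰ vanishes for τ; the Herbrand quotient
-- of a finite module is 1, so Ĥ⁻¹ vanishes too, and hence Ĥ⁰ vanishes for −τ.  Vanishing of Ĥ⁰ and
-- Ĥ⁻¹ for T² gives vanishing of Ĥ⁰ for T, so by descending induction on b it holds for every T_{b,e};
-- for b = 0 this is ε_ψ M = M^ψ.  Finally 1 − T maps Fix T² onto Fix (−T) with kernel Fix T, and
-- −T_{b,e} = T_{b,e+2^{n-b-1}}, so [Fix T_{b+1,e}] = [Fix T_{b,e}]·[Fix T_{b,e+2^{n-b-1}}]; unwinding
-- this from [M] = [Fix T_{n,0}] gives [M] = ∏_e [Fix T_{0,e}].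

{-# OPTIONS --safe #-}

module Submission where

open import Level using (Level; _⊔_)
open import Algebra.Bundles using (AbelianGroup; CommutativeRing)
open import Data.Nat using (ℕ; zero; suc; _+_; _*_; _^_; _∸_; _≤_; _<_; z≤n; >-nonZero)
open import Data.Nat.Properties
  using ( +-comm; +-suc; +-identityʳ; +-mono-≤; +-commutativeSemigroup; *-comm; *-assoc; *-suc
        ; *-identityˡ; *-identityʳ; *-zeroʳ; *-distribˡ-+; *-distribʳ-+; *-cancelʳ-≡; *-monoʳ-≤
        ; ^-distribˡ-+-*; m^n>0; suc-injective; m+[n∸m]≡n; m∸n+n≡m; m<m+n; <⇒≤; <⇒≱
        ; ≤-refl; ≤-reflexive; ≤-trans; module ≤-Reasoning )
open import Data.Nat.ListAction using (sum; product)
open import Data.Nat.Solver using (module +-*-Solver)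
open import Data.Fin using (Fin; toℕ; fromℕ<)
import Data.Fin as Fin
open import Data.Fin.Properties using (toℕ-fromℕ<; toℕ<n)
open import Data.List using (List; []; _∷_; length; filter; map; foldr; tabulate; allFin; applyUpTo)
open import Data.List.Properties using (filter-all; map-tabulate)
open import Data.List.Relation.Unary.Any using (Any; here; there)
import Data.List.Relation.Unary.Any as Any
open import Data.List.Relation.Unary.All using (All; []; _∷_)
import Data.List.Relation.Unary.All as All
open import Data.List.Relation.Unary.All.Properties using (All¬⇒¬Any)
open import Data.List.Relation.Unary.AllPairs using (AllPairs; []; _∷_)
open import Data.Product using (_×_; _,_; ∃-syntax; proj₁; proj₂)
open import Function.Base using (_∘_)
open import Relation.Nullary using (Dec; yes; no; ¬_; ¬?; contradiction)
open import Relation.Nullary.Decidable using (_×-dec_)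
open import Relation.Unary using (Pred; Decidable; _⊆_)
open import Relation.Binary using (Setoid)
import Relation.Binary as B
open import Relation.Binary.Core using (_Preserves_⟶_)
open import Relation.Binary.Definitions using (_Respects_)
open import Relation.Binary.PropositionalEquality as ≡ using (_≡_; refl)
import Relation.Binary.Reasoning.Setoid as SetoidReasoning
open import Algebra.Properties.CommutativeSemigroup +-commutativeSemigroup
  using () renaming (interchange to +-interchange)
open import Defs

indicator : ∀ {p} {P : Set p} → Dec P → ℕ
indicator (yes _) = 1
indicator (no _)  = 0

indicator-cong : ∀ {p q} {P : Set p} {Q : Set q} → (P → Q) → (Q → P) →
                 (d : Dec P) (e : Dec Q) → indicator d ≡ indicator e
indicator-cong _ _ (yes _) (yes _) = refl
indicator-cong f _ (yes p) (no ¬q) = contradiction (f p) ¬q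
indicator-cong _ g (no ¬p) (yes q) = contradiction (g q) ¬p
indicator-cong _ _ (no _)  (no _)  = refl

indicator-× : ∀ {p q} {P : Set p} {Q : Set q} (d : Dec P) (e : Dec Q) →
              indicator (d ×-dec e) ≡ indicator d * indicator e
indicator-× (yes _) (yes _) = refl
indicator-× (yes _) (no _)  = refl
indicator-× (no _)  _       = refl

module _ {a} {A : Set a} where

  ∑ : List A → (A → ℕ) → ℕ
  ∑ xs f = sum (map f xs)

  syntax ∑ xs (λ x → e) = ∑[ x ∈ xs ] e

  ∑-cong : ∀ xs {f g : A → ℕ} → (∀ x → f x ≡ g x) → ∑ xs f ≡ ∑ xs g
  ∑-cong []       _ = refl
  ∑-cong (x ∷ xs) e = ≡.cong₂ _+_ (e x) (∑-cong xs e)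

  ∑-mono : ∀ xs {f g : A → ℕ} → (∀ x → f x ≤ g x) → ∑ xs f ≤ ∑ xs g
  ∑-mono []       _ = z≤n
  ∑-mono (x ∷ xs) e = +-mono-≤ (e x) (∑-mono xs e)

  ∑-zero : ∀ xs → ∑[ x ∈ xs ] 0 ≡ 0
  ∑-zero []       = refl
  ∑-zero (_ ∷ xs) = ∑-zero xs

  ∑-distrib-+ : ∀ xs (f g : A → ℕ) → ∑[ x ∈ xs ] (f x + g x) ≡ ∑ xs f + ∑ xs g
  ∑-distrib-+ []       _ _ = refl
  ∑-distrib-+ (x ∷ xs) f g = ≡.trans (≡.cong (f x + g x +_) (∑-distrib-+ xs f g))
                                   (+-interchange (f x) (g x) (∑ xs f) (∑ xs g))

  ∑-*ˡ : ∀ xs c (f : A → ℕ) → ∑[ x ∈ xs ] (c * f x) ≡ c * ∑ xs f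
  ∑-*ˡ []       c _ = ≡.sym (*-zeroʳ c)
  ∑-*ˡ (x ∷ xs) c f = ≡.trans (≡.cong (c * f x +_) (∑-*ˡ xs c f)) (≡.sym (*-distribˡ-+ c (f x) (∑ xs f)))

  ∑-*ʳ : ∀ xs c (f : A → ℕ) → ∑[ x ∈ xs ] (f x * c) ≡ ∑ xs f * c
  ∑-*ʳ xs c f = ≡.trans (∑-cong xs (λ x → *-comm (f x) c)) (≡.trans (∑-*ˡ xs c f) (*-comm c (∑ xs f)))

  ∑-comm : ∀ xs ys (f : A → A → ℕ) → ∑[ x ∈ xs ] ∑[ y ∈ ys ] f x y ≡ ∑[ y ∈ ys ] ∑[ x ∈ xs ] f x y
  ∑-comm []       ys f = ≡.sym (∑-zero ys)
  ∑-comm (x ∷ xs) ys f = ≡.trans (≡.cong (∑ ys (f x) +_) (∑-comm xs ys f))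
                              (≡.sym (∑-distrib-+ ys (f x) (λ y → ∑[ x′ ∈ xs ] f x′ y)))

  length-filter≡∑ : ∀ {p} {P : Pred A p} (P? : Decidable P) xs →
                    length (filter P? xs) ≡ ∑[ x ∈ xs ] indicator (P? x)
  length-filter≡∑ P? []       = refl
  length-filter≡∑ P? (x ∷ xs) with P? x
  ... | yes _ = ≡.cong suc (length-filter≡∑ P? xs)
  ... | no _  = length-filter≡∑ P? xs

record IsFiniteSetoid {c ℓ} (S : Setoid c ℓ) : Set (c ⊔ ℓ) where
  open Setoid S
  field
    _≟_      : B.Decidable _≈_
    elems    : List Carrier
    complete : ∀ x → Any (x ≈_) elems
    distinct : AllPairs (λ x y → ¬ x ≈ y) elems

module FiniteSetoid {c ℓ} (S : Setoid c ℓ) (finite : IsFiniteSetoid S) where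

  open Setoid S using (Carrier; _≈_) renaming (sym to ≈-sym; trans to ≈-trans)
  open IsFiniteSetoid finite

  count : ∀ {p} {P : Pred Carrier p} → Decidable P → ℕ
  count P? = ∑[ x ∈ elems ] indicator (P? x)

  module _ {p q} {P : Pred Carrier p} {Q : Pred Carrier q} (P? : Decidable P) (Q? : Decidable Q) where

    count-cong : P ⊆ Q → Q ⊆ P → count P? ≡ count Q?
    count-cong P⊆Q Q⊆P = ∑-cong elems (λ x → indicator-cong P⊆Q Q⊆P (P? x) (Q? x))

    count-mono : P ⊆ Q → count P? ≤ count Q?
    count-mono P⊆Q = ∑-mono elems (λ x → mono (P? x) (Q? x))
      where
      mono : ∀ {x} (d : Dec (P x)) (e : Dec (Q x)) → indicator d ≤ indicator e
      mono (yes p) (no ¬q) = contradiction (P⊆Q p) ¬q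
      mono (yes _) (yes _) = ≤-refl
      mono (no _)  _       = z≤n

  count-singleton : ∀ y → count (_≟ y) ≡ 1
  count-singleton y = once elems (complete y) distinct
    where
    none : ∀ xs → All (λ z → ¬ z ≈ y) xs → ∑[ x ∈ xs ] indicator (x ≟ y) ≡ 0
    none []       []           = refl
    none (x ∷ xs) (x≉y ∷ xs≉y) with x ≟ y
    ... | yes x≈y = contradiction x≈y x≉y
    ... | no _    = none xs xs≉y
    once : ∀ xs → Any (y ≈_) xs → AllPairs (λ x z → ¬ x ≈ z) xs → ∑[ x ∈ xs ] indicator (x ≟ y) ≡ 1
    once (x ∷ xs) (here y≈x) (x≉xs ∷ _) with x ≟ y
    ... | yes _   =
      ≡.cong suc (none xs (All.map (λ x≉z z≈y → x≉z (≈-trans (≈-sym y≈x) (≈-sym z≈y))) x≉xs))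
    ... | no x≉y  = contradiction (≈-sym y≈x) x≉y
    once (x ∷ xs) (there y∈xs) (x≉xs ∷ xs-distinct) with x ≟ y
    ... | yes x≈y = contradiction y∈xs (All¬⇒¬Any (All.map (λ x≉z y≈z → x≉z (≈-trans x≈y y≈z)) x≉xs))
    ... | no _    = once xs y∈xs xs-distinct

  ∑-δ : ∀ {h : Carrier → ℕ} → h Preserves _≈_ ⟶ _≡_ →
        ∀ y → ∑[ x ∈ elems ] (indicator (x ≟ y) * h x) ≡ h y
  ∑-δ {h} h-resp y = begin
    ∑[ x ∈ elems ] (indicator (x ≟ y) * h x)  ≡⟨ ∑-cong elems (λ x → at-y (x ≟ y)) ⟩
    ∑[ x ∈ elems ] (indicator (x ≟ y) * h y)  ≡⟨ ∑-*ʳ elems (h y) (λ x → indicator (x ≟ y)) ⟩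
    count (_≟ y) * h y                        ≡⟨ ≡.cong (_* h y) (count-singleton y) ⟩
    1 * h y                                   ≡⟨ *-identityˡ (h y) ⟩
    h y                                       ∎
    where
    open ≡.≡-Reasoning
    at-y : ∀ {x} (d : Dec (x ≈ y)) → indicator d * h x ≡ indicator d * h y
    at-y (yes x≈y) = ≡.cong (1 *_) (h-resp x≈y)
    at-y (no _)    = refl

  ∑-bijection : ∀ (g g⁻¹ : Carrier → Carrier) → g Preserves _≈_ ⟶ _≈_ → g⁻¹ Preserves _≈_ ⟶ _≈_ →
                (∀ y → g (g⁻¹ y) ≈ y) → (∀ x → g⁻¹ (g x) ≈ x) →
                ∀ {h : Carrier → ℕ} → h Preserves _≈_ ⟶ _≡_ → ∑ elems h ≡ ∑[ x ∈ elems ] h (g x)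
  ∑-bijection g g⁻¹ g-cong g⁻¹-cong gg⁻¹ g⁻¹g {h} h-resp = ≡.sym (begin
    ∑[ x ∈ elems ] h (g x)
      ≡⟨ ∑-cong elems (λ x → ≡.sym (∑-δ h-resp (g x))) ⟩
    ∑[ x ∈ elems ] ∑[ y ∈ elems ] (indicator (y ≟ g x) * h y)
      ≡⟨ ∑-comm elems elems _ ⟩
    ∑[ y ∈ elems ] ∑[ x ∈ elems ] (indicator (y ≟ g x) * h y)
      ≡⟨ ∑-cong elems (λ y → ∑-*ʳ elems (h y) _) ⟩
    ∑[ y ∈ elems ] (∑[ x ∈ elems ] indicator (y ≟ g x) * h y)
      ≡⟨ ∑-cong elems (λ y → ≡.cong (_* h y) (preimage y)) ⟩
    ∑[ y ∈ elems ] (1 * h y)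
      ≡⟨ ∑-cong elems (λ y → *-identityˡ (h y)) ⟩
    ∑ elems h
      ∎)
    where
    open ≡.≡-Reasoning
    preimage : ∀ y → ∑[ x ∈ elems ] indicator (y ≟ g x) ≡ 1
    preimage y = ≡.trans (∑-cong elems (λ x → indicator-cong
                          (λ y≈gx → ≈-trans (≈-sym (g⁻¹g x)) (g⁻¹-cong (≈-sym y≈gx)))
                          (λ x≈g⁻¹y → ≈-trans (≈-sym (gg⁻¹ y)) (g-cong (≈-sym x≈g⁻¹y)))
                          (y ≟ g x) (x ≟ g⁻¹ y)))
                       (count-singleton (g⁻¹ y))

  count-inhabited : ∀ {p} {P : Pred Carrier p} (P? : Decidable P) → P Respects _≈_ → ∀ {x} → P x → 1 ≤ count P?
  count-inhabited P? P-resp {x} px =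
    ≤-trans (≤-reflexive (≡.sym (count-singleton x))) (count-mono (_≟ x) P? (λ z≈x → P-resp (≈-sym z≈x) px))

  count-⊆⇒⊇ : ∀ {p q} {P : Pred Carrier p} {Q : Pred Carrier q} (P? : Decidable P) (Q? : Decidable Q) →
              P Respects _≈_ → Q Respects _≈_ → P ⊆ Q → count Q? ≤ count P? → Q ⊆ P
  count-⊆⇒⊇ {P = P} {Q} P? Q? P-resp Q-resp P⊆Q Q≤P {x} qx with P? x
  ... | yes px = px
  ... | no ¬px = contradiction Q≤P (<⇒≱ (begin-strict
      count P?                    <⟨ m<m+n (count P?) (count-inhabited Q∖P? Q∖P-resp (qx , ¬px)) ⟩
      count P? + count Q∖P?       ≡⟨ ≡.sym (∑-distrib-+ elems _ _) ⟩
      ∑[ z ∈ elems ] (indicator (P? z) + indicator (Q∖P? z)) ≡⟨ ∑-cong elems (λ z → split (Q? z) (P? z)) ⟩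
      count Q?                    ∎))
    where
    open ≤-Reasoning
    Q∖P? : Decidable (λ z → Q z × ¬ P z)
    Q∖P? z = Q? z ×-dec ¬? (P? z)
    Q∖P-resp : (λ z → Q z × ¬ P z) Respects _≈_
    Q∖P-resp u≈v (qu , ¬pu) = Q-resp u≈v qu , λ pv → ¬pu (P-resp (≈-sym u≈v) pv)
    split : ∀ {z} (d : Dec (Q z)) (e : Dec (P z)) → indicator e + indicator (d ×-dec ¬? e) ≡ indicator d
    split (yes _) (yes _) = refl
    split (yes _) (no _)  = refl
    split (no ¬q) (yes p) = contradiction (P⊆Q p) ¬q
    split (no _)  (no _)  = refl

  count-universal : ∀ {p} {P : Pred Carrier p} (P? : Decidable P) → (∀ x → P x) → count P? ≡ length elems
  count-universal P? P-all =
    ≡.trans (≡.sym (length-filter≡∑ P? elems)) (≡.cong length (filter-all P? (All.universal P-all elems)))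

iter-shift : ∀ {a} {A : Set a} k (f : A → A) x → iter k f (f x) ≡ f (iter k f x)
iter-shift zero    f x = refl
iter-shift (suc k) f x = ≡.cong f (iter-shift k f x)

iter-+ : ∀ {a} {A : Set a} m n (f : A → A) x → iter (m + n) f x ≡ iter m f (iter n f x)
iter-+ zero    n f x = refl
iter-+ (suc m) n f x = ≡.cong f (iter-+ m n f x)

iter-* : ∀ {a} {A : Set a} m n (f : A → A) x → iter (m * n) f x ≡ iter m (iter n f) x
iter-* zero    n f x = refl
iter-* (suc m) n f x = ≡.trans (iter-+ n (m * n) f x) (≡.cong (iter n f) (iter-* m n f x))

module AbelianGroupEndomorphisms {c ℓ} (G : AbelianGroup c ℓ) where

  open AbelianGroup G renaming
    ( _≈_ to _≈ᴹ_; _∙_ to _+ᴹ_; ε to 0ᴹ; _⁻¹ to -ᴹ_; _-_ to _-ᴹ_; setoid to ≈ᴹ-setoid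
    ; refl to ≈ᴹ-refl; sym to ≈ᴹ-sym; trans to ≈ᴹ-trans
    ; ∙-cong to +ᴹ-cong; ∙-congˡ to +ᴹ-congˡ; ∙-congʳ to +ᴹ-congʳ; assoc to +ᴹ-assoc; comm to +ᴹ-comm
    ; identityˡ to +ᴹ-identityˡ; inverseʳ to -ᴹ‿inverseʳ; ⁻¹-cong to -ᴹ‿cong; group to +ᴹ-group
    ; commutativeMonoid to +ᴹ-commutativeMonoid; commutativeSemigroup to +ᴹ-commutativeSemigroup )
    using (Carrier)
  open import Algebra.Properties.Group +ᴹ-group
    using (x∙y⁻¹≈ε⇒x≈y; x≈y⇒x∙y⁻¹≈ε; inverseʳ-unique; //-rightDividesˡ; //-rightDividesʳ)
  open import Algebra.Properties.AbelianGroup G using (⁻¹-∙-comm)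
  open import Algebra.Properties.CommutativeSemigroup +ᴹ-commutativeSemigroup using (interchange)
  open import Algebra.Properties.CommutativeMonoid.Mult +ᴹ-commutativeMonoid
    using (×-congʳ; ×-assocˡ; ×-distrib-+) renaming (_×_ to _·_)
  private module ≈-Reasoning = SetoidReasoning ≈ᴹ-setoid

  -ᴹ-+ᴹ : ∀ x y → -ᴹ (x +ᴹ y) ≈ᴹ -ᴹ x +ᴹ -ᴹ y
  -ᴹ-+ᴹ x y = ≈ᴹ-sym (⁻¹-∙-comm x y)

  -ᴹ-interchange : ∀ a b c d → (a +ᴹ b) -ᴹ (c +ᴹ d) ≈ᴹ (a -ᴹ c) +ᴹ (b -ᴹ d)
  -ᴹ-interchange a b c d = ≈ᴹ-trans (+ᴹ-congˡ (-ᴹ-+ᴹ c d)) (interchange a b (-ᴹ c) (-ᴹ d))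

  -ᴹ-telescope : ∀ a b c → (a -ᴹ b) +ᴹ (b -ᴹ c) ≈ᴹ a -ᴹ c
  -ᴹ-telescope a b c = begin
    (a -ᴹ b) +ᴹ (b -ᴹ c)   ≈⟨ +ᴹ-assoc (a -ᴹ b) b (-ᴹ c) ⟨
    ((a -ᴹ b) +ᴹ b) -ᴹ c   ≈⟨ +ᴹ-congʳ (//-rightDividesˡ b a) ⟩
    a -ᴹ c                 ∎
    where open ≈-Reasoning

  record IsEndo (f : Carrier → Carrier) : Set (c ⊔ ℓ) where
    field
      cong : ∀ {x y} → x ≈ᴹ y → f x ≈ᴹ f y
      homo : ∀ x y → f (x +ᴹ y) ≈ᴹ f x +ᴹ f y

    0-homo : f 0ᴹ ≈ᴹ 0ᴹ
    0-homo = begin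
      f 0ᴹ                    ≈⟨ //-rightDividesʳ (f 0ᴹ) (f 0ᴹ) ⟨
      (f 0ᴹ +ᴹ f 0ᴹ) -ᴹ f 0ᴹ  ≈⟨ +ᴹ-congʳ (homo 0ᴹ 0ᴹ) ⟨
      f (0ᴹ +ᴹ 0ᴹ) -ᴹ f 0ᴹ    ≈⟨ +ᴹ-congʳ (cong (+ᴹ-identityˡ 0ᴹ)) ⟩
      f 0ᴹ -ᴹ f 0ᴹ            ≈⟨ -ᴹ‿inverseʳ (f 0ᴹ) ⟩
      0ᴹ                      ∎
      where open ≈-Reasoning

    -ᴹ-homo : ∀ x → f (-ᴹ x) ≈ᴹ -ᴹ f x
    -ᴹ-homo x = inverseʳ-unique (f x) (f (-ᴹ x)) (begin
      f x +ᴹ f (-ᴹ x)  ≈⟨ homo x (-ᴹ x) ⟨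
      f (x -ᴹ x)       ≈⟨ cong (-ᴹ‿inverseʳ x) ⟩
      f 0ᴹ             ≈⟨ 0-homo ⟩
      0ᴹ               ∎)
      where open ≈-Reasoning

    -ᴹ-homo₂ : ∀ x y → f (x -ᴹ y) ≈ᴹ f x -ᴹ f y
    -ᴹ-homo₂ x y = ≈ᴹ-trans (homo x (-ᴹ y)) (+ᴹ-congˡ (-ᴹ-homo y))

    ·-homo : ∀ k x → f (k · x) ≈ᴹ k · f x
    ·-homo zero    x = 0-homo
    ·-homo (suc k) x = ≈ᴹ-trans (homo x (k · x)) (+ᴹ-congˡ (·-homo k x))

    fix-resp : ∀ {x y} → x ≈ᴹ y → f x ≈ᴹ x → f y ≈ᴹ y
    fix-resp x≈y fx≈x = ≈ᴹ-trans (cong (≈ᴹ-sym x≈y)) (≈ᴹ-trans fx≈x x≈y)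

  open IsEndo public

  id-isEndo : IsEndo (λ x → x)
  id-isEndo = record { cong = λ x≈y → x≈y ; homo = λ _ _ → ≈ᴹ-refl }

  ∘-isEndo : ∀ {f g} → IsEndo f → IsEndo g → IsEndo (f ∘ g)
  ∘-isEndo {f} {g} f-endo g-endo = record
    { cong = cong f-endo ∘ cong g-endo
    ; homo = λ x y → ≈ᴹ-trans (cong f-endo (homo g-endo x y)) (homo f-endo (g x) (g y)) }

  iter-isEndo : ∀ {f} k → IsEndo f → IsEndo (iter k f)
  iter-isEndo zero    _      = id-isEndo
  iter-isEndo (suc k) f-endo = ∘-isEndo f-endo (iter-isEndo k f-endo)

  -ᴹ-isEndo : ∀ {f} → IsEndo f → IsEndo (λ x → -ᴹ f x)
  -ᴹ-isEndo f-endo = record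
    { cong = -ᴹ‿cong ∘ cong f-endo
    ; homo = λ x y → ≈ᴹ-trans (-ᴹ‿cong (homo f-endo x y)) (-ᴹ-+ᴹ _ _) }

  -ᴹ-isEndo₂ : ∀ {f g} → IsEndo f → IsEndo g → IsEndo (λ x → f x -ᴹ g x)
  -ᴹ-isEndo₂ {f} {g} f-endo g-endo = record
    { cong = λ x≈y → +ᴹ-cong (cong f-endo x≈y) (-ᴹ‿cong (cong g-endo x≈y))
    ; homo = λ x y → ≈ᴹ-trans (+ᴹ-cong (homo f-endo x y) (-ᴹ‿cong (homo g-endo x y)))
                              (-ᴹ-interchange (f x) (f y) (g x) (g y)) }

  isEndo-cong : ∀ {f g} → IsEndo f → (∀ x → f x ≈ᴹ g x) → IsEndo g
  isEndo-cong f-endo f≈g = record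
    { cong = λ x≈y → ≈ᴹ-trans (≈ᴹ-sym (f≈g _)) (≈ᴹ-trans (cong f-endo x≈y) (f≈g _))
    ; homo = λ x y → ≈ᴹ-trans (≈ᴹ-sym (f≈g _)) (≈ᴹ-trans (homo f-endo x y) (+ᴹ-cong (f≈g x) (f≈g y))) }

  iter-cong : ∀ {f g} k → IsEndo f → (∀ x → f x ≈ᴹ g x) → ∀ x → iter k f x ≈ᴹ iter k g x
  iter-cong zero    _      _   _ = ≈ᴹ-refl
  iter-cong (suc k) f-endo f≈g x = ≈ᴹ-trans (cong f-endo (iter-cong k f-endo f≈g x)) (f≈g _)

  norm : ℕ → (Carrier → Carrier) → Carrier → Carrier
  norm zero    T x = 0ᴹ
  norm (suc k) T x = x +ᴹ norm k T (T x)

  norm-isEndo : ∀ {T} k → IsEndo T → IsEndo (norm k T)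
  norm-isEndo zero    _      = record { cong = λ _ → ≈ᴹ-refl ; homo = λ _ _ → ≈ᴹ-sym (+ᴹ-identityˡ 0ᴹ) }
  norm-isEndo {T} (suc k) T-endo = record
    { cong = λ x≈y → +ᴹ-cong x≈y (cong N-endo (cong T-endo x≈y))
    ; homo = λ x y → ≈ᴹ-trans (+ᴹ-congˡ (≈ᴹ-trans (cong N-endo (homo T-endo x y)) (homo N-endo (T x) (T y))))
                              (interchange x y _ _) }
    where N-endo = norm-isEndo k T-endo

  module _ {T : Carrier → Carrier} (T-endo : IsEndo T) where

    norm-congᶠ : ∀ {T′} k → (∀ x → T x ≈ᴹ T′ x) → ∀ x → norm k T x ≈ᴹ norm k T′ x
    norm-congᶠ zero    _    _ = ≈ᴹ-refl
    norm-congᶠ (suc k) T≈T′ x =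
      +ᴹ-congˡ (≈ᴹ-trans (cong (norm-isEndo k T-endo) (T≈T′ x)) (norm-congᶠ k T≈T′ _))

    norm-comm : ∀ {S} k → IsEndo S → (∀ x → S (T x) ≈ᴹ T (S x)) → ∀ x → S (norm k T x) ≈ᴹ norm k T (S x)
    norm-comm zero    S-endo _  _ = 0-homo S-endo
    norm-comm (suc k) S-endo ST x = ≈ᴹ-trans (homo S-endo _ _)
      (+ᴹ-congˡ (≈ᴹ-trans (norm-comm k S-endo ST _) (cong (norm-isEndo k T-endo) (ST x))))

    norm-fixed : ∀ k {x} → T x ≈ᴹ x → norm k T x ≈ᴹ k · x
    norm-fixed zero    _     = ≈ᴹ-refl
    norm-fixed (suc k) Tx≈x = +ᴹ-congˡ (≈ᴹ-trans (cong (norm-isEndo k T-endo) Tx≈x) (norm-fixed k Tx≈x))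

    norm-telescope : ∀ k x → norm k T (x -ᴹ T x) ≈ᴹ x -ᴹ iter k T x
    norm-telescope zero    x = ≈ᴹ-sym (-ᴹ‿inverseʳ x)
    norm-telescope (suc k) x = begin
      (x -ᴹ T x) +ᴹ norm k T (T (x -ᴹ T x))
        ≈⟨ +ᴹ-congˡ (cong (norm-isEndo k T-endo) (-ᴹ-homo₂ T-endo x (T x))) ⟩
      (x -ᴹ T x) +ᴹ norm k T (T x -ᴹ T (T x))
        ≈⟨ +ᴹ-congˡ (norm-telescope k (T x)) ⟩
      (x -ᴹ T x) +ᴹ (T x -ᴹ iter k T (T x))
        ≈⟨ -ᴹ-telescope x (T x) _ ⟩
      x -ᴹ iter k T (T x)
        ≡⟨ ≡.cong (λ y → x -ᴹ y) (iter-shift k T x) ⟩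
      x -ᴹ T (iter k T x)
        ∎
      where open ≈-Reasoning

    norm-+ : ∀ k x → norm (k + k) T x ≈ᴹ norm k (T ∘ T) (x +ᴹ T x)
    norm-+ zero    x = ≈ᴹ-refl
    norm-+ (suc k) x = begin
      x +ᴹ norm (k + suc k) T (T x)
        ≡⟨ ≡.cong (λ j → x +ᴹ norm j T (T x)) (+-suc k k) ⟩
      x +ᴹ (T x +ᴹ norm (k + k) T (T (T x)))
        ≈⟨ +ᴹ-congˡ (+ᴹ-congˡ (norm-+ k (T (T x)))) ⟩
      x +ᴹ (T x +ᴹ norm k (T ∘ T) (T (T x) +ᴹ T (T (T x))))
        ≈⟨ +ᴹ-assoc x (T x) _ ⟨
      (x +ᴹ T x) +ᴹ norm k (T ∘ T) (T (T x) +ᴹ T (T (T x)))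
        ≈⟨ +ᴹ-congˡ (cong N-endo (homo T²-endo x (T x))) ⟨
      (x +ᴹ T x) +ᴹ norm k (T ∘ T) (T (T (x +ᴹ T x)))
        ∎
      where
      open ≈-Reasoning
      T²-endo = ∘-isEndo T-endo T-endo
      N-endo  = norm-isEndo k T²-endo

    norm-fixedBy : ∀ k → (∀ x → iter k T x ≈ᴹ x) → ∀ x → T (norm k T x) ≈ᴹ norm k T x
    norm-fixedBy k Tᵏ≈id x = ≈ᴹ-sym (x∙y⁻¹≈ε⇒x≈y _ _ (begin
      norm k T x -ᴹ T (norm k T x)   ≈⟨ +ᴹ-congˡ (-ᴹ‿cong (norm-comm k T-endo (λ _ → ≈ᴹ-refl) x)) ⟩
      norm k T x -ᴹ norm k T (T x)   ≈⟨ -ᴹ-homo₂ (norm-isEndo k T-endo) x (T x) ⟨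
      norm k T (x -ᴹ T x)            ≈⟨ norm-telescope k x ⟩
      x -ᴹ iter k T x                ≈⟨ x≈y⇒x∙y⁻¹≈ε (≈ᴹ-sym (Tᵏ≈id x)) ⟩
      0ᴹ                             ∎))
      where open ≈-Reasoning

  Fix : (Carrier → Carrier) → Pred Carrier ℓ
  Fix T x = T x ≈ᴹ x

  Ker : (Carrier → Carrier) → Pred Carrier ℓ
  Ker f x = f x ≈ᴹ 0ᴹ

  module _ {f : Carrier → Carrier} (f-endo : IsEndo f) where

    fix-+ : ∀ {x y} → Fix f x → Fix f y → Fix f (x +ᴹ y)
    fix-+ fx≈x fy≈y = ≈ᴹ-trans (homo f-endo _ _) (+ᴹ-cong fx≈x fy≈y)

    fix-cancelʳ : ∀ {x y} → Fix f y → Fix f (x +ᴹ y) → Fix f x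
    fix-cancelʳ {x} {y} fy≈y f[x+y]≈x+y = begin
      f x                    ≈⟨ //-rightDividesʳ (f y) (f x) ⟨
      (f x +ᴹ f y) -ᴹ f y    ≈⟨ +ᴹ-cong (homo f-endo x y) (-ᴹ‿cong (≈ᴹ-sym fy≈y)) ⟨
      f (x +ᴹ y) -ᴹ y        ≈⟨ +ᴹ-congʳ f[x+y]≈x+y ⟩
      (x +ᴹ y) -ᴹ y          ≈⟨ //-rightDividesʳ y x ⟩
      x                      ∎
      where open ≈-Reasoning

    fiber-shift⇒ker : ∀ {x x₀ y} → y ≈ᴹ f x₀ → y ≈ᴹ f (x +ᴹ x₀) → Ker f x
    fiber-shift⇒ker {x} {x₀} {y} y≈fx₀ y≈f[x+x₀] = begin
      f x                     ≈⟨ //-rightDividesʳ (f x₀) (f x) ⟨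
      (f x +ᴹ f x₀) -ᴹ f x₀   ≈⟨ +ᴹ-cong (homo f-endo x x₀) (-ᴹ‿cong y≈fx₀) ⟨
      f (x +ᴹ x₀) -ᴹ y        ≈⟨ x≈y⇒x∙y⁻¹≈ε (≈ᴹ-sym y≈f[x+x₀]) ⟩
      0ᴹ                      ∎
      where open ≈-Reasoning

    ker⇒fiber-shift : ∀ {x x₀ y} → y ≈ᴹ f x₀ → Ker f x → y ≈ᴹ f (x +ᴹ x₀)
    ker⇒fiber-shift {x} {x₀} {y} y≈fx₀ fx≈0 = begin
      y             ≈⟨ y≈fx₀ ⟩
      f x₀          ≈⟨ +ᴹ-identityˡ (f x₀) ⟨
      0ᴹ +ᴹ f x₀    ≈⟨ +ᴹ-congʳ fx≈0 ⟨
      f x +ᴹ f x₀   ≈⟨ homo f-endo x x₀ ⟨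
      f (x +ᴹ x₀)   ∎
      where open ≈-Reasoning

  Δ : (Carrier → Carrier) → Carrier → Carrier
  Δ T x = x -ᴹ T x

  Δ-isEndo : ∀ {T} → IsEndo T → IsEndo (Δ T)
  Δ-isEndo T-endo = -ᴹ-isEndo₂ id-isEndo T-endo

  Ker-Δ⇒Fix : ∀ T {x} → Ker (Δ T) x → Fix T x
  Ker-Δ⇒Fix _ Δx≈0 = ≈ᴹ-sym (x∙y⁻¹≈ε⇒x≈y _ _ Δx≈0)

  Fix⇒Ker-Δ : ∀ T {x} → Fix T x → Ker (Δ T) x
  Fix⇒Ker-Δ _ Tx≈x = x≈y⇒x∙y⁻¹≈ε (≈ᴹ-sym Tx≈x)

  Ĥ⁰-vanishes : ℕ → (Carrier → Carrier) → Set (c ⊔ ℓ)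
  Ĥ⁰-vanishes k T = ∀ x → Fix T x → ∃[ y ] x ≈ᴹ norm k T y

  Ĥ⁻¹-vanishes : ℕ → (Carrier → Carrier) → Set (c ⊔ ℓ)
  Ĥ⁻¹-vanishes k T = ∀ x → Ker (norm k T) x → ∃[ y ] x ≈ᴹ Δ T y

  Ĥ⁰-vanishes-cong : ∀ {T T′} k → IsEndo T → (∀ x → T x ≈ᴹ T′ x) →
                     Ĥ⁰-vanishes k T → Ĥ⁰-vanishes k T′
  Ĥ⁰-vanishes-cong k T-endo T≈T′ Ĥ⁰T x T′x≈x =
    let (y , x≈Ny) = Ĥ⁰T x (≈ᴹ-trans (T≈T′ x) T′x≈x)
    in  y , ≈ᴹ-trans x≈Ny (norm-congᶠ T-endo k T≈T′ y)

  module _ {T : Carrier → Carrier} (T-endo : IsEndo T) where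

    private
      T²-endo : IsEndo (T ∘ T)
      T²-endo = ∘-isEndo T-endo T-endo

      Δ-norm₂ : ∀ w → Δ T (w +ᴹ T w) ≈ᴹ w -ᴹ T (T w)
      Δ-norm₂ w = begin
        (w +ᴹ T w) -ᴹ T (w +ᴹ T w)        ≈⟨ +ᴹ-congˡ (-ᴹ‿cong (homo T-endo w (T w))) ⟩
        (w +ᴹ T w) -ᴹ (T w +ᴹ T (T w))    ≈⟨ -ᴹ-interchange w (T w) (T w) (T (T w)) ⟩
        (w -ᴹ T w) +ᴹ (T w -ᴹ T (T w))    ≈⟨ -ᴹ-telescope w (T w) (T (T w)) ⟩
        w -ᴹ T (T w)                      ∎
        where open ≈-Reasoning

    fixed≈norm+multiple : ∀ q → Ĥ⁰-vanishes q (T ∘ T) → Ĥ⁻¹-vanishes q (T ∘ T) →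
                          ∀ x → Fix T x → ∃[ w ] ∃[ κ ] Fix T κ × x ≈ᴹ norm (q + q) T w +ᴹ q · κ
    fixed≈norm+multiple q Ĥ⁰T² Ĥ⁻¹T² x Tx≈x = w , κ , Tκ≈κ , x≈Nw+qκ
      where
      N² = norm q (T ∘ T)
      N²-endo = norm-isEndo q T²-endo
      z-spec = Ĥ⁰T² x (≈ᴹ-trans (cong T-endo Tx≈x) Tx≈x)
      z = proj₁ z-spec
      N²Δz≈0 : N² (Δ T z) ≈ᴹ 0ᴹ
      N²Δz≈0 = begin
        N² (Δ T z)    ≈⟨ norm-comm T²-endo q (Δ-isEndo T-endo) (λ u → ≈ᴹ-sym (-ᴹ-homo₂ T²-endo u (T u))) z ⟨
        Δ T (N² z)    ≈⟨ cong (Δ-isEndo T-endo) (proj₂ z-spec) ⟨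
        Δ T x         ≈⟨ Fix⇒Ker-Δ T Tx≈x ⟩
        0ᴹ            ∎
        where open ≈-Reasoning
      w-spec = Ĥ⁻¹T² (Δ T z) N²Δz≈0
      w = proj₁ w-spec
      κ = z -ᴹ (w +ᴹ T w)
      Tκ≈κ : Fix T κ
      Tκ≈κ = Ker-Δ⇒Fix T (begin
        Δ T κ                     ≈⟨ -ᴹ-homo₂ (Δ-isEndo T-endo) z (w +ᴹ T w) ⟩
        Δ T z -ᴹ Δ T (w +ᴹ T w)   ≈⟨ +ᴹ-congˡ (-ᴹ‿cong (Δ-norm₂ w)) ⟩
        Δ T z -ᴹ (w -ᴹ T (T w))   ≈⟨ x≈y⇒x∙y⁻¹≈ε (proj₂ w-spec) ⟩
        0ᴹ                        ∎)
        where open ≈-Reasoning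
      x≈Nw+qκ : x ≈ᴹ norm (q + q) T w +ᴹ q · κ
      x≈Nw+qκ = begin
        x                           ≈⟨ proj₂ z-spec ⟩
        N² z                        ≈⟨ cong N²-endo (//-rightDividesˡ (w +ᴹ T w) z) ⟨
        N² (κ +ᴹ (w +ᴹ T w))        ≈⟨ homo N²-endo κ (w +ᴹ T w) ⟩
        N² κ +ᴹ N² (w +ᴹ T w)       ≈⟨ +ᴹ-cong (norm-fixed T²-endo q (≈ᴹ-trans (cong T-endo Tκ≈κ) Tκ≈κ))
                                               (≈ᴹ-sym (norm-+ T-endo q w)) ⟩
        q · κ +ᴹ norm (q + q) T w   ≈⟨ +ᴹ-comm (q · κ) _ ⟩
        norm (q + q) T w +ᴹ q · κ   ∎
        where open ≈-Reasoning

    -- Two rounds of fixed≈norm+multiple leave q²κ′ = (q + q)·(k·κ′), itself a norm since q = 2k.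
    Ĥ⁰-vanishes-of-square : ∀ k → Ĥ⁰-vanishes (k + k) (T ∘ T) → Ĥ⁻¹-vanishes (k + k) (T ∘ T) →
                            Ĥ⁰-vanishes ((k + k) + (k + k)) T
    Ĥ⁰-vanishes-of-square k Ĥ⁰T² Ĥ⁻¹T² x Tx≈x = w +ᴹ (q · w′ +ᴹ k · κ′) , (begin
      x                                   ≈⟨ x≈Nw+qκ ⟩
      N w +ᴹ q · κ                        ≈⟨ +ᴹ-congˡ (×-congʳ q κ≈Nw′+qκ′) ⟩
      N w +ᴹ q · (N w′ +ᴹ q · κ′)         ≈⟨ +ᴹ-congˡ (×-distrib-+ (N w′) (q · κ′) q) ⟩
      N w +ᴹ (q · N w′ +ᴹ q · (q · κ′))   ≈⟨ +ᴹ-congˡ (+ᴹ-cong (≈ᴹ-sym (·-homo N-endo q w′)) q²κ′≈N[kκ′]) ⟩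
      N w +ᴹ (N (q · w′) +ᴹ N (k · κ′))   ≈⟨ +ᴹ-congˡ (homo N-endo (q · w′) (k · κ′)) ⟨
      N w +ᴹ N (q · w′ +ᴹ k · κ′)         ≈⟨ homo N-endo w (q · w′ +ᴹ k · κ′) ⟨
      N (w +ᴹ (q · w′ +ᴹ k · κ′))         ∎)
      where
      open ≈-Reasoning
      q = k + k
      N = norm (q + q) T
      N-endo = norm-isEndo (q + q) T-endo
      first  = fixed≈norm+multiple q Ĥ⁰T² Ĥ⁻¹T² x Tx≈x
      w      = proj₁ first
      κ      = proj₁ (proj₂ first)
      x≈Nw+qκ = proj₂ (proj₂ (proj₂ first))
      second = fixed≈norm+multiple q Ĥ⁰T² Ĥ⁻¹T² κ (proj₁ (proj₂ (proj₂ first)))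
      w′     = proj₁ second
      κ′     = proj₁ (proj₂ second)
      Tκ′≈κ′ = proj₁ (proj₂ (proj₂ second))
      κ≈Nw′+qκ′ = proj₂ (proj₂ (proj₂ second))
      q²κ′≈N[kκ′] : q · (q · κ′) ≈ᴹ N (k · κ′)
      q²κ′≈N[kκ′] = begin
        q · (q · κ′)         ≈⟨ ×-assocˡ κ′ q q ⟩
        (q * q) · κ′         ≡⟨ ≡.cong (_· κ′) (≡.trans (*-distribˡ-+ q k k) (≡.sym (*-distribʳ-+ k q q))) ⟩
        ((q + q) * k) · κ′   ≈⟨ ×-assocˡ κ′ (q + q) k ⟨
        (q + q) · (k · κ′)   ≈⟨ norm-fixed T-endo (q + q) T[kκ′]≈kκ′ ⟨
        N (k · κ′)           ∎
        where
        T[kκ′]≈kκ′ : T (k · κ′) ≈ᴹ k · κ′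
        T[kκ′]≈kκ′ = ≈ᴹ-trans (·-homo T-endo k κ′) (×-congʳ k Tκ′≈κ′)

module FiniteAbelianGroup {c ℓ} (G : AbelianGroup c ℓ) (finite : IsFiniteSetoid (AbelianGroup.setoid G))
  where

  open AbelianGroupEndomorphisms G public
  open FiniteSetoid (AbelianGroup.setoid G) finite public
  open IsFiniteSetoid finite renaming (_≟_ to _≟ᴹ_)
  open AbelianGroup G using (Carrier) renaming
    ( _≈_ to _≈ᴹ_; _∙_ to _+ᴹ_; ε to 0ᴹ; _⁻¹ to -ᴹ_; _-_ to _-ᴹ_; setoid to ≈ᴹ-setoid
    ; refl to ≈ᴹ-refl; sym to ≈ᴹ-sym; trans to ≈ᴹ-trans; reflexive to ≈ᴹ-reflexive
    ; ∙-congˡ to +ᴹ-congˡ; ∙-congʳ to +ᴹ-congʳ; identityʳ to +ᴹ-identityʳ; inverseʳ to -ᴹ‿inverseʳ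
    ; ⁻¹-cong to -ᴹ‿cong; group to +ᴹ-group )
  open import Algebra.Properties.Group +ᴹ-group
    using (x≈y⇒x∙y⁻¹≈ε; ⁻¹-involutive; //-rightDividesˡ; //-rightDividesʳ)
  open import Algebra.Properties.AbelianGroup G using (⁻¹-anti-homo‿-)
  private module ≈-Reasoning = SetoidReasoning ≈ᴹ-setoid

  fix? : ∀ T → Decidable (Fix T)
  fix? T x = T x ≟ᴹ x

  ker? : ∀ f → Decidable (Ker f)
  ker? f x = f x ≟ᴹ 0ᴹ

  Image : ∀ {p} → (Carrier → Carrier) → Pred Carrier p → Pred Carrier (c ⊔ ℓ ⊔ p)
  Image f P y = Any (λ x → P x × y ≈ᴹ f x) elems

  image? : ∀ {p} {P : Pred Carrier p} (f : Carrier → Carrier) → Decidable P → Decidable (Image f P)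
  image? f P? y = Any.any? (λ x → P? x ×-dec (y ≟ᴹ f x)) elems

  image-resp : ∀ {p} {P : Pred Carrier p} {f y y′} → y ≈ᴹ y′ → Image f P y → Image f P y′
  image-resp y≈y′ = Any.map (λ (px , y≈fx) → px , ≈ᴹ-trans (≈ᴹ-sym y≈y′) y≈fx)

  fix-image-intro : ∀ {f g} → IsEndo f → IsEndo g → ∀ {x y} → Fix g x → y ≈ᴹ f x → Image f (Fix g) y
  fix-image-intro f-endo g-endo {x} gx≈x y≈fx =
    Any.map (λ x≈x′ → fix-resp g-endo x≈x′ gx≈x , ≈ᴹ-trans y≈fx (cong f-endo x≈x′)) (complete x)

  module _ {f g} (f-endo : IsEndo f) (g-endo : IsEndo g) where

    private
      fiber : Carrier → Carrier → ℕ
      fiber y x = indicator (fix? g x) * indicator (y ≟ᴹ f x)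

      K : ℕ
      K = count (λ x → fix? g x ×-dec ker? f x)

      fiber-count : ∀ y → ∑[ x ∈ elems ] fiber y x ≡ indicator (image? f (fix? g) y) * K
      fiber-count y with image? f (fix? g) y
      ... | no y∉im = ≡.trans (∑-cong elems (λ x → outside (fix? g x) (y ≟ᴹ f x))) (∑-zero elems)
        where
        outside : ∀ {x} (d : Dec (Fix g x)) (e : Dec (y ≈ᴹ f x)) → indicator d * indicator e ≡ 0
        outside (yes gx≈x) (yes y≈fx) = contradiction (fix-image-intro f-endo g-endo gx≈x y≈fx) y∉im
        outside (yes _)    (no _)     = refl
        outside (no _)     _          = refl
      ... | yes y∈im with Any.satisfied y∈im
      ... | x₀ , gx₀≈x₀ , y≈fx₀ = begin
        ∑[ x ∈ elems ] fiber y x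
          ≡⟨ ∑-bijection (_+ᴹ x₀) (_-ᴹ x₀) +ᴹ-congʳ +ᴹ-congʳ
                         (λ x → //-rightDividesˡ x₀ x) (λ x → //-rightDividesʳ x₀ x) fiber-resp ⟩
        ∑[ x ∈ elems ] fiber y (x +ᴹ x₀)
          ≡⟨ ∑-cong elems shifted ⟩
        K
          ≡⟨ +-identityʳ K ⟨
        1 * K
          ∎
        where
        open ≡.≡-Reasoning
        fiber-resp : ∀ {u v} → u ≈ᴹ v → fiber y u ≡ fiber y v
        fiber-resp u≈v = ≡.cong₂ _*_
          (indicator-cong (fix-resp g-endo u≈v) (fix-resp g-endo (≈ᴹ-sym u≈v)) (fix? g _) (fix? g _))
          (indicator-cong (λ y≈fu → ≈ᴹ-trans y≈fu (cong f-endo u≈v))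
                          (λ y≈fv → ≈ᴹ-trans y≈fv (cong f-endo (≈ᴹ-sym u≈v)))
                          (y ≟ᴹ f _) (y ≟ᴹ f _))
        shifted : ∀ x → fiber y (x +ᴹ x₀) ≡ indicator (fix? g x ×-dec ker? f x)
        shifted x = ≡.trans
          (≡.cong₂ _*_ (indicator-cong (fix-cancelʳ g-endo gx₀≈x₀) (λ gx≈x → fix-+ g-endo gx≈x gx₀≈x₀)
                                       (fix? g (x +ᴹ x₀)) (fix? g x))
                       (indicator-cong (fiber-shift⇒ker f-endo y≈fx₀) (ker⇒fiber-shift f-endo y≈fx₀)
                                       (y ≟ᴹ f (x +ᴹ x₀)) (ker? f x)))
          (≡.sym (indicator-× (fix? g x) (ker? f x)))

    count-fix≡count-ker*count-image : count (fix? g) ≡ K * count (image? f (fix? g))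
    count-fix≡count-ker*count-image = begin
      count (fix? g)
        ≡⟨ ∑-cong elems (λ x → ≡.sym (once x)) ⟩
      ∑[ x ∈ elems ] (indicator (fix? g x) * count (_≟ᴹ f x))
        ≡⟨ ∑-cong elems (λ x → ∑-*ˡ elems (indicator (fix? g x)) _) ⟨
      ∑[ x ∈ elems ] ∑[ y ∈ elems ] fiber y x
        ≡⟨ ∑-comm elems elems (λ x y → fiber y x) ⟩
      ∑[ y ∈ elems ] ∑[ x ∈ elems ] fiber y x
        ≡⟨ ∑-cong elems fiber-count ⟩
      ∑[ y ∈ elems ] (indicator (image? f (fix? g) y) * K)
        ≡⟨ ∑-*ʳ elems K _ ⟩
      count (image? f (fix? g)) * K
        ≡⟨ *-comm _ K ⟩
      K * count (image? f (fix? g))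
        ∎
      where
      open ≡.≡-Reasoning
      once : ∀ x → indicator (fix? g x) * count (_≟ᴹ f x) ≡ indicator (fix? g x)
      once x = ≡.trans (≡.cong (indicator (fix? g x) *_) (count-singleton (f x))) (*-identityʳ _)

  module _ {T : Carrier → Carrier} (T-endo : IsEndo T) where

    -- [M] = [ker N]·[im N] = [ker Δ]·[im Δ] with im N = Fix T = ker Δ, so im Δ ⊆ ker N have equal size.
    Ĥ⁰-vanishes⇒Ĥ⁻¹-vanishes : ∀ {k} → (∀ x → iter k T x ≈ᴹ x) → Ĥ⁰-vanishes k T → Ĥ⁻¹-vanishes k T
    Ĥ⁰-vanishes⇒Ĥ⁻¹-vanishes {k} Tᵏ≈id Ĥ⁰T x Nx≈0 =
      let (z , _ , x≈Δz) = Any.satisfied (ker-N⊆image-Δ (≈ᴹ-refl , Nx≈0)) in z , x≈Δz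
      where
      N = norm k T
      N-endo = norm-isEndo k T-endo
      fix-id? = fix? (λ x → x)
      ker-N? = λ x → fix-id? x ×-dec ker? N x
      image-Δ? = image? (Δ T) fix-id?

      image-N≡Fix : count (image? N fix-id?) ≡ count (fix? T)
      image-N≡Fix = count-cong (image? N fix-id?) (fix? T)
        (λ y∈im → let (z , _ , y≈Nz) = Any.satisfied y∈im in
                  fix-resp T-endo (≈ᴹ-sym y≈Nz) (norm-fixedBy T-endo k Tᵏ≈id z))
        (λ {y} Ty≈y → let (z , y≈Nz) = Ĥ⁰T y Ty≈y in fix-image-intro N-endo id-isEndo ≈ᴹ-refl y≈Nz)

      ker-Δ≡Fix : count (λ x → fix-id? x ×-dec ker? (Δ T) x) ≡ count (fix? T)
      ker-Δ≡Fix = count-cong _ (fix? T) (Ker-Δ⇒Fix T ∘ proj₂) (λ Tx≈x → ≈ᴹ-refl , Fix⇒Ker-Δ T Tx≈x)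

      #ker-N≡#image-Δ : count ker-N? ≡ count image-Δ?
      #ker-N≡#image-Δ = *-cancelʳ-≡ _ _ (count (fix? T)) {{>-nonZero #Fix≥1}} (begin
        count ker-N? * count (fix? T)
          ≡⟨ ≡.cong (count ker-N? *_) image-N≡Fix ⟨
        count ker-N? * count (image? N fix-id?)
          ≡⟨ count-fix≡count-ker*count-image N-endo id-isEndo ⟨
        count fix-id?
          ≡⟨ count-fix≡count-ker*count-image (Δ-isEndo T-endo) id-isEndo ⟩
        count (λ x → fix-id? x ×-dec ker? (Δ T) x) * count image-Δ?
          ≡⟨ ≡.cong (_* count image-Δ?) ker-Δ≡Fix ⟩
        count (fix? T) * count image-Δ?
          ≡⟨ *-comm (count (fix? T)) _ ⟩
        count image-Δ? * count (fix? T)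
          ∎)
        where
        open ≡.≡-Reasoning
        #Fix≥1 : 1 ≤ count (fix? T)
        #Fix≥1 = count-inhabited (fix? T) (fix-resp T-endo) (0-homo T-endo)

      ker-N⊆image-Δ : ∀ {y} → Fix (λ x → x) y × Ker N y → Image (Δ T) (Fix (λ x → x)) y
      ker-N⊆image-Δ = count-⊆⇒⊇ image-Δ? ker-N? image-resp
        (λ u≈v (_ , Nu≈0) → ≈ᴹ-refl , ≈ᴹ-trans (cong N-endo (≈ᴹ-sym u≈v)) Nu≈0)
        (λ y∈im → let (z , _ , y≈Δz) = Any.satisfied y∈im in
                  ≈ᴹ-refl , ≈ᴹ-trans (cong N-endo y≈Δz) (≈ᴹ-trans (norm-telescope T-endo k z)
                                                                  (x≈y⇒x∙y⁻¹≈ε (≈ᴹ-sym (Tᵏ≈id z)))))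
        (≤-reflexive #ker-N≡#image-Δ)

    private
      T²-endo : IsEndo (T ∘ T)
      T²-endo = ∘-isEndo T-endo T-endo

    count-fix-square : ∀ {T′} q → (∀ x → iter (q + q) T x ≈ᴹ x) → (∀ x → T′ x ≈ᴹ -ᴹ T x) →
                       Ĥ⁰-vanishes (q + q) T′ → count (fix? (T ∘ T)) ≡ count (fix? T) * count (fix? T′)
    count-fix-square {T′} q T²ᑫ≈id T′≈-T Ĥ⁰T′ =
      ≡.trans (count-fix≡count-ker*count-image (Δ-isEndo T-endo) T²-endo)
              (≡.cong₂ _*_ ker-Δ≡Fix-T image-Δ≡Fix-T′)
      where
      N² = norm q (T ∘ T)
      N²-endo = norm-isEndo q T²-endo
      T′-endo : IsEndo T′
      T′-endo = isEndo-cong (-ᴹ-isEndo T-endo) (λ x → ≈ᴹ-sym (T′≈-T x))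
      T′²≈T² : ∀ x → T′ (T′ x) ≈ᴹ T (T x)
      T′²≈T² x = begin
        T′ (T′ x)        ≈⟨ T′≈-T (T′ x) ⟩
        -ᴹ T (T′ x)      ≈⟨ -ᴹ‿cong (cong T-endo (T′≈-T x)) ⟩
        -ᴹ T (-ᴹ T x)    ≈⟨ -ᴹ‿cong (-ᴹ-homo T-endo (T x)) ⟩
        -ᴹ -ᴹ T (T x)    ≈⟨ ⁻¹-involutive (T (T x)) ⟩
        T (T x)          ∎
        where open ≈-Reasoning
      norm-fixed-by-T² : ∀ w → Fix (T ∘ T) (N² w)
      norm-fixed-by-T² = norm-fixedBy T²-endo q (λ x → ≈ᴹ-trans
        (≈ᴹ-reflexive (≡.trans (≡.sym (iter-* q 2 T x)) (≡.cong (λ j → iter j T x) q*2≡q+q)))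
        (T²ᑫ≈id x))
        where
        q*2≡q+q : q * 2 ≡ q + q
        q*2≡q+q = ≡.trans (*-comm q 2) (≡.cong (q +_) (+-identityʳ q))

      ker-Δ≡Fix-T : count (λ x → fix? (T ∘ T) x ×-dec ker? (Δ T) x) ≡ count (fix? T)
      ker-Δ≡Fix-T = count-cong _ (fix? T) (Ker-Δ⇒Fix T ∘ proj₂)
        (λ Tx≈x → ≈ᴹ-trans (cong T-endo Tx≈x) Tx≈x , Fix⇒Ker-Δ T Tx≈x)

      image⊆Fix-T′ : ∀ {y} → Image (Δ T) (Fix (T ∘ T)) y → Fix T′ y
      image⊆Fix-T′ {y} y∈im = let (x , T²x≈x , y≈Dx) = Any.satisfied y∈im in begin
        T′ y                  ≈⟨ T′≈-T y ⟩
        -ᴹ T y                ≈⟨ -ᴹ‿cong (≈ᴹ-trans (cong T-endo y≈Dx) (-ᴹ-homo₂ T-endo x (T x))) ⟩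
        -ᴹ (T x -ᴹ T (T x))   ≈⟨ -ᴹ‿cong (+ᴹ-congˡ (-ᴹ‿cong T²x≈x)) ⟩
        -ᴹ (T x -ᴹ x)         ≈⟨ ⁻¹-anti-homo‿- (T x) x ⟩
        x -ᴹ T x              ≈⟨ y≈Dx ⟨
        y                     ∎
        where open ≈-Reasoning

      Fix-T′⊆image : ∀ {y} → Fix T′ y → Image (Δ T) (Fix (T ∘ T)) y
      Fix-T′⊆image {y} T′y≈y = let (w , y≈N′w) = Ĥ⁰T′ y T′y≈y in
        fix-image-intro (Δ-isEndo T-endo) T²-endo (norm-fixed-by-T² w) (begin
          y                              ≈⟨ y≈N′w ⟩
          norm (q + q) T′ w              ≈⟨ norm-+ T′-endo q w ⟩
          norm q (T′ ∘ T′) (w +ᴹ T′ w)   ≈⟨ norm-congᶠ (∘-isEndo T′-endo T′-endo) q T′²≈T² _ ⟩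
          N² (w +ᴹ T′ w)                 ≈⟨ cong N²-endo (+ᴹ-congˡ (T′≈-T w)) ⟩
          N² (w -ᴹ T w)                  ≈⟨ -ᴹ-homo₂ N²-endo w (T w) ⟩
          N² w -ᴹ N² (T w)               ≈⟨ +ᴹ-congˡ (-ᴹ‿cong (norm-comm T²-endo q T-endo (λ _ → ≈ᴹ-refl) w)) ⟨
          Δ T (N² w)                     ∎)
        where open ≈-Reasoning

      image-Δ≡Fix-T′ : count (image? (Δ T) (fix? (T ∘ T))) ≡ count (fix? T′)
      image-Δ≡Fix-T′ = count-cong (image? (Δ T) (fix? (T ∘ T))) (fix? T′) image⊆Fix-T′ Fix-T′⊆image

    Ĥ⁰-vanishes-neg : (∀ x → T (T x) ≈ᴹ x) → Ĥ⁰-vanishes 2 T → Ĥ⁰-vanishes 2 (λ x → -ᴹ T x)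
    Ĥ⁰-vanishes-neg T²≈id Ĥ⁰T x -Tx≈x =
      let (y , x≈Δy) = Ĥ⁰-vanishes⇒Ĥ⁻¹-vanishes {2} T²≈id Ĥ⁰T x N₂x≈0 in
      y , ≈ᴹ-trans x≈Δy (+ᴹ-congˡ (≈ᴹ-sym (+ᴹ-identityʳ (-ᴹ T y))))
      where
      N₂x≈0 : x +ᴹ (T x +ᴹ 0ᴹ) ≈ᴹ 0ᴹ
      N₂x≈0 = begin
        x +ᴹ (T x +ᴹ 0ᴹ)   ≈⟨ +ᴹ-congˡ (+ᴹ-identityʳ (T x)) ⟩
        x +ᴹ T x           ≈⟨ +ᴹ-congˡ (⁻¹-involutive (T x)) ⟨
        x +ᴹ -ᴹ -ᴹ T x     ≈⟨ +ᴹ-congˡ (-ᴹ‿cong -Tx≈x) ⟩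
        x +ᴹ -ᴹ x          ≈⟨ -ᴹ‿inverseʳ x ⟩
        0ᴹ                 ∎
        where open ≈-Reasoning

2^[1+d]≡2^d+2^d : ∀ d → 2 ^ suc d ≡ 2 ^ d + 2 ^ d
2^[1+d]≡2^d+2^d d = ≡.cong (2 ^ d +_) (+-identityʳ (2 ^ d))

∏< : ℕ → (ℕ → ℕ) → ℕ
∏< k g = product (applyUpTo g k)

syntax ∏< k (λ t → e) = ∏[ t < k ] e

∏-cong : ∀ k {g g′ : ℕ → ℕ} → (∀ t → g t ≡ g′ t) → ∏< k g ≡ ∏< k g′
∏-cong zero    _     = refl
∏-cong (suc k) g≡g′ = ≡.cong₂ _*_ (g≡g′ 0) (∏-cong k (g≡g′ ∘ suc))

∏-even-odd : ∀ k (g : ℕ → ℕ) → ∏[ t < k + k ] g t ≡ ∏[ t < k ] g (t + t) * ∏[ t < k ] g (suc (t + t))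
∏-even-odd zero    g = refl
∏-even-odd (suc k) g =
  ≡.trans (≡.cong (λ i → g 0 * ∏< i (g ∘ suc)) (+-suc k k))
  (≡.trans (≡.cong (λ p → g 0 * (g 1 * p)) (∏-even-odd k (g ∘ suc ∘ suc)))
  (≡.trans (rearrange (g 0) (g 1) _ _)
           (≡.cong₂ (λ p p′ → (g 0 * p) * (g 1 * p′))
                    (∏-cong k (λ t → ≡.cong (g ∘ suc) (≡.sym (+-suc t t))))
                    (∏-cong k (λ t → ≡.cong (g ∘ suc ∘ suc) (≡.sym (+-suc t t)))))))
  where
  open +-*-Solver
  rearrange : ∀ a b c d → a * (b * (c * d)) ≡ (a * c) * (b * d)
  rearrange = solve 4 (λ a b c d → a :* (b :* (c :* d)) := (a :* c) :* (b :* d)) refl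

product-tabulate : ∀ k (f : Fin k → ℕ) (g : ℕ → ℕ) → (∀ j → f j ≡ g (toℕ j)) →
                   product (tabulate f) ≡ ∏< k g
product-tabulate zero    f g _   = refl
product-tabulate (suc k) f g f≡g =
  ≡.cong₂ _*_ (f≡g Fin.zero) (product-tabulate k (f ∘ Fin.suc) (g ∘ suc) (f≡g ∘ Fin.suc))

product-allFin : ∀ k (f : Fin k → ℕ) (g : ℕ → ℕ) → (∀ j → f j ≡ g (toℕ j)) →
                 product (map f (allFin k)) ≡ ∏< k g
product-allFin k f g f≡g = ≡.trans (≡.cong product (map-tabulate (λ j → j) f)) (product-tabulate k f g f≡g)

module CommutativeRingProperties {r ℓr} (R : CommutativeRing r ℓr) where

  private module R = CommutativeRing R
  open R using (1#) renaming (_≈_ to _≈ᴿ_; _*_ to _*ᴿ_; -_ to -ᴿ_)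
  open import Algebra.Properties.CommutativeSemiring.Exp R.commutativeSemiring using () renaming (_^_ to _^ᴿ_)
  open import Algebra.Properties.Ring R.ring using (-1*x≈-x; -‿involutive)
  private module ≈ᴿ-Reasoning = SetoidReasoning R.setoid

  pow≡^ᴿ : ∀ x k → pow R x k ≡ x ^ᴿ k
  pow≡^ᴿ x zero    = refl
  pow≡^ᴿ x (suc k) = ≡.cong (x *ᴿ_) (pow≡^ᴿ x k)

  1^ᴿ≈1 : ∀ k → 1# ^ᴿ k ≈ᴿ 1#
  1^ᴿ≈1 zero    = R.refl
  1^ᴿ≈1 (suc k) = R.trans (R.*-identityˡ _) (1^ᴿ≈1 k)

  -1*-1≈1 : -ᴿ 1# *ᴿ -ᴿ 1# ≈ᴿ 1#
  -1*-1≈1 = R.trans (-1*x≈-x (-ᴿ 1#)) (-‿involutive 1#)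

  inverse-unique : ∀ {a b x} → a *ᴿ x ≈ᴿ 1# → b *ᴿ x ≈ᴿ 1# → a ≈ᴿ b
  inverse-unique {a} {b} {x} ax≈1 bx≈1 = begin
    a               ≈⟨ R.*-identityʳ a ⟨
    a *ᴿ 1#         ≈⟨ R.*-congˡ bx≈1 ⟨
    a *ᴿ (b *ᴿ x)   ≈⟨ R.*-congˡ (R.*-comm b x) ⟩
    a *ᴿ (x *ᴿ b)   ≈⟨ R.*-assoc a x b ⟨
    (a *ᴿ x) *ᴿ b   ≈⟨ R.*-congʳ ax≈1 ⟩
    1# *ᴿ b         ≈⟨ R.*-identityˡ b ⟩
    b               ∎
    where open ≈ᴿ-Reasoning

module TwistedAction {r ℓr m ℓm} (R : CommutativeRing r ℓr) (n : ℕ)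
  (Z : ZetaHom R (suc n)) (A : RGModule R (suc n) m ℓm) (F : FiniteRGModule R A) where

  module R = CommutativeRing R
  open R using (1#; 0#) renaming (Carrier to Scalar; _≈_ to _≈ᴿ_; _*_ to _*ᴿ_; -_ to -ᴿ_)
  open import Algebra.Properties.CommutativeSemiring.Exp R.commutativeSemiring
    using (^-homo-*; ^-assocʳ; ^-congˡ; ^-distrib-*) renaming (_^_ to _^ᴿ_)
  open import Algebra.Properties.Ring R.ring using (+-inverseˡ-unique)
  open CommutativeRingProperties R
  open ZetaHom Z
  open RGModule A
  open FiniteRGModule F

  private
    finite : IsFiniteSetoid ≈ᴹ-setoid
    finite = record { _≟_ = _≟ᴹ_ ; elems = elems ; complete = complete ; distinct = distinct }

  open FiniteAbelianGroup +ᴹ-abelianGroup finite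
  open import Algebra.Module.Properties M using (inverseʳ-uniqueᴹ)
  private
    module ≈ᴿ-Reasoning = SetoidReasoning R.setoid
    module ≈-Reasoning = SetoidReasoning ≈ᴹ-setoid

  h N : ℕ
  h = 2 ^ n
  N = 2 ^ suc n

  N≡h+h : N ≡ h + h
  N≡h+h = ≡.cong (h +_) (+-identityʳ h)

  ζ^h≈-1 : ζ ^ᴿ h ≈ᴿ -ᴿ 1#
  ζ^h≈-1 = +-inverseˡ-unique (ζ ^ᴿ h) 1#
             (R.trans (R.+-congʳ (R.reflexive (≡.sym (pow≡^ᴿ ζ h)))) cyclotomic)

  ^ᴿ-h+h : ∀ {x} → x ^ᴿ h ≈ᴿ -ᴿ 1# → x ^ᴿ N ≈ᴿ 1#
  ^ᴿ-h+h {x} xʰ≈-1 = begin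
    x ^ᴿ N                   ≡⟨ ≡.cong (x ^ᴿ_) N≡h+h ⟩
    x ^ᴿ (h + h)             ≈⟨ ^-homo-* x h h ⟩
    x ^ᴿ h *ᴿ x ^ᴿ h         ≈⟨ R.*-cong xʰ≈-1 xʰ≈-1 ⟩
    -ᴿ 1# *ᴿ -ᴿ 1#           ≈⟨ -1*-1≈1 ⟩
    1#                       ∎
    where open ≈ᴿ-Reasoning

  ζ^N≈1 : ζ ^ᴿ N ≈ᴿ 1#
  ζ^N≈1 = ^ᴿ-h+h ζ^h≈-1

  ω : Scalar
  ω = ζ ^ᴿ (N ∸ 1)

  ζ^k*ω^k≈1 : ∀ k → ζ ^ᴿ k *ᴿ ω ^ᴿ k ≈ᴿ 1#
  ζ^k*ω^k≈1 k = begin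
    ζ ^ᴿ k *ᴿ ω ^ᴿ k     ≈⟨ ^-distrib-* ζ ω k ⟨
    (ζ *ᴿ ω) ^ᴿ k        ≈⟨ ^-congˡ k ζω≈1 ⟩
    1# ^ᴿ k              ≈⟨ 1^ᴿ≈1 k ⟩
    1#                   ∎
    where
    open ≈ᴿ-Reasoning
    ζω≈1 : ζ *ᴿ ω ≈ᴿ 1#
    ζω≈1 = R.trans (R.reflexive (≡.cong (ζ ^ᴿ_) (m+[n∸m]≡n {1} {N} (m^n>0 2 (suc n))))) ζ^N≈1

  ω^h≈-1 : ω ^ᴿ h ≈ᴿ -ᴿ 1#
  ω^h≈-1 = inverse-unique (R.trans (R.*-comm _ _) (ζ^k*ω^k≈1 h)) (R.trans (R.*-congˡ ζ^h≈-1) -1*-1≈1)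

  ω^N≈1 : ω ^ᴿ N ≈ᴿ 1#
  ω^N≈1 = ^ᴿ-h+h ω^h≈-1

  -1*ₗx≈-x : ∀ x → -ᴿ 1# *ₗ x ≈ᴹ -ᴹ x
  -1*ₗx≈-x x = inverseʳ-uniqueᴹ x (-ᴿ 1# *ₗ x) (begin
    x +ᴹ -ᴿ 1# *ₗ x            ≈⟨ +ᴹ-congʳ (*ₗ-identityˡ x) ⟨
    1# *ₗ x +ᴹ -ᴿ 1# *ₗ x      ≈⟨ *ₗ-distribʳ x 1# (-ᴿ 1#) ⟨
    (1# R.+ -ᴿ 1#) *ₗ x        ≈⟨ *ₗ-congʳ (R.-‿inverseʳ 1#) ⟩
    0# *ₗ x                    ≈⟨ *ₗ-zeroˡ x ⟩
    0ᴹ                         ∎)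
    where open ≈-Reasoning

  σ-isEndo : IsEndo σ
  σ-isEndo = record { cong = σ-cong ; homo = σ-+ }

  iter-σ-*ₗ : ∀ k a x → iter k σ (a *ₗ x) ≈ᴹ a *ₗ iter k σ x
  iter-σ-*ₗ zero    a x = ≈ᴹ-refl
  iter-σ-*ₗ (suc k) a x = ≈ᴹ-trans (σ-cong (iter-σ-*ₗ k a x)) (σ-*ₗ a _)

  -- twist b e is T_{b,e} = ψ_e(σ^{2^b})⁻¹ σ^{2^b}; here |G| = 2^{n+1}.
  twist : ℕ → ℕ → Carrierᴹ → Carrierᴹ
  twist b e x = ω ^ᴿ (e * 2 ^ b) *ₗ iter (2 ^ b) σ x

  *ₗ-isEndo : ∀ a → IsEndo (a *ₗ_)
  *ₗ-isEndo a = record { cong = *ₗ-congˡ ; homo = *ₗ-distribˡ a }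

  twist-isEndo : ∀ b e → IsEndo (twist b e)
  twist-isEndo b e = ∘-isEndo (*ₗ-isEndo _) (iter-isEndo (2 ^ b) σ-isEndo)

  iter-twist : ∀ b e j x → iter j (twist b e) x ≈ᴹ ω ^ᴿ (e * 2 ^ b * j) *ₗ iter (j * 2 ^ b) σ x
  iter-twist b e zero    x =
    ≈ᴹ-sym (≈ᴹ-trans (*ₗ-congʳ (R.reflexive (≡.cong (ω ^ᴿ_) (*-zeroʳ (e * 2 ^ b))))) (*ₗ-identityˡ x))
  iter-twist b e (suc j) x = begin
    a *ₗ S (iter j (twist b e) x)
      ≈⟨ *ₗ-congˡ (cong (iter-isEndo (2 ^ b) σ-isEndo) (iter-twist b e j x)) ⟩
    a *ₗ S (ω ^ᴿ (e * 2 ^ b * j) *ₗ iter (j * 2 ^ b) σ x)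
      ≈⟨ *ₗ-congˡ (iter-σ-*ₗ (2 ^ b) _ _) ⟩
    a *ₗ (ω ^ᴿ (e * 2 ^ b * j) *ₗ S (iter (j * 2 ^ b) σ x))
      ≈⟨ *ₗ-assoc a _ _ ⟨
    (a *ᴿ ω ^ᴿ (e * 2 ^ b * j)) *ₗ S (iter (j * 2 ^ b) σ x)
      ≈⟨ *ₗ-congʳ (^-homo-* ω (e * 2 ^ b) _) ⟨
    ω ^ᴿ (e * 2 ^ b + e * 2 ^ b * j) *ₗ S (iter (j * 2 ^ b) σ x)
      ≡⟨ ≡.cong₂ (λ i y → ω ^ᴿ i *ₗ y) (≡.sym (*-suc (e * 2 ^ b) j)) (≡.sym (iter-+ (2 ^ b) (j * 2 ^ b) σ x)) ⟩
    ω ^ᴿ (e * 2 ^ b * suc j) *ₗ iter (suc j * 2 ^ b) σ x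
      ∎
    where
    open ≈-Reasoning
    a = ω ^ᴿ (e * 2 ^ b)
    S = iter (2 ^ b) σ

  twist-order : ∀ b c → b + c ≡ suc n → ∀ e x → iter (2 ^ c) (twist b e) x ≈ᴹ x
  twist-order b c b+c≡1+n e x = begin
    iter (2 ^ c) (twist b e) x
      ≈⟨ iter-twist b e (2 ^ c) x ⟩
    ω ^ᴿ (e * 2 ^ b * 2 ^ c) *ₗ iter (2 ^ c * 2 ^ b) σ x
      ≡⟨ ≡.cong₂ (λ i j → ω ^ᴿ i *ₗ iter j σ x) e2^b2^c≡Ne 2^c2^b≡N ⟩
    ω ^ᴿ (N * e) *ₗ iter N σ x
      ≈⟨ *ₗ-cong ω^[Ne]≈1 (σ-order x) ⟩
    1# *ₗ x
      ≈⟨ *ₗ-identityˡ x ⟩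
    x
      ∎
    where
    open ≈-Reasoning
    2^c2^b≡N : 2 ^ c * 2 ^ b ≡ N
    2^c2^b≡N = ≡.trans (≡.sym (^-distribˡ-+-* 2 c b)) (≡.cong (2 ^_) (≡.trans (+-comm c b) b+c≡1+n))
    e2^b2^c≡Ne : e * 2 ^ b * 2 ^ c ≡ N * e
    e2^b2^c≡Ne = ≡.trans (*-assoc e (2 ^ b) (2 ^ c))
                  (≡.trans (≡.cong (e *_) (≡.trans (*-comm (2 ^ b) (2 ^ c)) 2^c2^b≡N)) (*-comm e N))
    ω^[Ne]≈1 : ω ^ᴿ (N * e) ≈ᴿ 1#
    ω^[Ne]≈1 = R.trans (R.sym (^-assocʳ ω N e)) (R.trans (^-congˡ e ω^N≈1) (1^ᴿ≈1 e))

  twist-square : ∀ b e x → twist b e (twist b e x) ≈ᴹ twist (suc b) e x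
  twist-square b e x = ≈ᴹ-trans (iter-twist b e 2 x) (*ₗ-congʳ (R.reflexive (≡.cong (ω ^ᴿ_) exponent)))
    where
    exponent : e * 2 ^ b * 2 ≡ e * 2 ^ suc b
    exponent = ≡.trans (*-assoc e (2 ^ b) 2) (≡.cong (e *_) (*-comm (2 ^ b) 2))

  twist-shift : ∀ b c → b + suc c ≡ suc n → ∀ e x → twist b (e + 2 ^ c) x ≈ᴹ -ᴹ twist b e x
  twist-shift b c b+1+c≡1+n e x = begin
    ω ^ᴿ ((e + 2 ^ c) * 2 ^ b) *ₗ y        ≡⟨ ≡.cong (λ i → ω ^ᴿ i *ₗ y) exponent ⟩
    ω ^ᴿ (e * 2 ^ b + h) *ₗ y              ≈⟨ *ₗ-congʳ (^-homo-* ω (e * 2 ^ b) h) ⟩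
    (ω ^ᴿ (e * 2 ^ b) *ᴿ ω ^ᴿ h) *ₗ y      ≈⟨ *ₗ-assoc _ _ y ⟩
    ω ^ᴿ (e * 2 ^ b) *ₗ (ω ^ᴿ h *ₗ y)      ≈⟨ *ₗ-congˡ (≈ᴹ-trans (*ₗ-congʳ ω^h≈-1) (-1*ₗx≈-x y)) ⟩
    ω ^ᴿ (e * 2 ^ b) *ₗ -ᴹ y               ≈⟨ -ᴹ-homo (*ₗ-isEndo _) y ⟩
    -ᴹ twist b e x                          ∎
    where
    open ≈-Reasoning
    y = iter (2 ^ b) σ x
    exponent : (e + 2 ^ c) * 2 ^ b ≡ e * 2 ^ b + h
    exponent = ≡.trans (*-distribʳ-+ (2 ^ b) e (2 ^ c))
      (≡.cong (e * 2 ^ b +_) (≡.trans (≡.sym (^-distribˡ-+-* 2 c b))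
        (≡.cong (2 ^_) (≡.trans (+-comm c b) (suc-injective (≡.trans (≡.sym (+-suc b c)) b+1+c≡1+n))))))

  σ-eigen⇒iter-eigen : ∀ {a x} → σ x ≈ᴹ a *ₗ x → ∀ l → iter l σ x ≈ᴹ a ^ᴿ l *ₗ x
  σ-eigen⇒iter-eigen {a} {x} σx≈ax zero    = ≈ᴹ-sym (*ₗ-identityˡ x)
  σ-eigen⇒iter-eigen {a} {x} σx≈ax (suc l) = begin
    σ (iter l σ x)           ≈⟨ σ-cong (σ-eigen⇒iter-eigen σx≈ax l) ⟩
    σ (a ^ᴿ l *ₗ x)          ≈⟨ σ-*ₗ (a ^ᴿ l) x ⟩
    a ^ᴿ l *ₗ σ x            ≈⟨ *ₗ-congˡ σx≈ax ⟩
    a ^ᴿ l *ₗ (a *ₗ x)       ≈⟨ *ₗ-assoc (a ^ᴿ l) a x ⟨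
    (a ^ᴿ l *ᴿ a) *ₗ x       ≈⟨ *ₗ-congʳ (R.*-comm (a ^ᴿ l) a) ⟩
    a ^ᴿ suc l *ₗ x          ∎
    where open ≈-Reasoning

  twist₀ : ∀ e x → twist 0 e x ≈ᴹ ω ^ᴿ e *ₗ σ x
  twist₀ e x = *ₗ-congʳ (R.reflexive (≡.cong (ω ^ᴿ_) (*-identityʳ e)))

  fix-twist₀⇒σ-eigen : ∀ e {x} → Fix (twist 0 e) x → σ x ≈ᴹ ζ ^ᴿ e *ₗ x
  fix-twist₀⇒σ-eigen e {x} fixed = begin
    σ x                            ≈⟨ *ₗ-identityˡ (σ x) ⟨
    1# *ₗ σ x                      ≈⟨ *ₗ-congʳ (ζ^k*ω^k≈1 e) ⟨
    (ζ ^ᴿ e *ᴿ ω ^ᴿ e) *ₗ σ x      ≈⟨ *ₗ-assoc _ _ (σ x) ⟩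
    ζ ^ᴿ e *ₗ (ω ^ᴿ e *ₗ σ x)      ≈⟨ *ₗ-congˡ (≈ᴹ-trans (≈ᴹ-sym (twist₀ e x)) fixed) ⟩
    ζ ^ᴿ e *ₗ x                    ∎
    where open ≈-Reasoning

  σ-eigen⇒fix-twist₀ : ∀ e {x} → σ x ≈ᴹ ζ ^ᴿ e *ₗ x → Fix (twist 0 e) x
  σ-eigen⇒fix-twist₀ e {x} σx≈ζᵉx = begin
    twist 0 e x                    ≈⟨ twist₀ e x ⟩
    ω ^ᴿ e *ₗ σ x                  ≈⟨ *ₗ-congˡ σx≈ζᵉx ⟩
    ω ^ᴿ e *ₗ (ζ ^ᴿ e *ₗ x)        ≈⟨ *ₗ-assoc _ _ x ⟨
    (ω ^ᴿ e *ᴿ ζ ^ᴿ e) *ₗ x        ≈⟨ *ₗ-congʳ (R.trans (R.*-comm _ _) (ζ^k*ω^k≈1 e)) ⟩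
    1# *ₗ x                        ≈⟨ *ₗ-identityˡ x ⟩
    x                              ∎
    where open ≈-Reasoning

  InEigen⇒fix-twist₀ : ∀ j {x} → InEigen R Z A j x → Fix (twist 0 (toℕ j)) x
  InEigen⇒fix-twist₀ j {x} eigen = σ-eigen⇒fix-twist₀ (toℕ j)
    (≡.subst (λ l → iter l σ x ≈ᴹ pow R ζ (toℕ j * l) *ₗ x → σ x ≈ᴹ ζ ^ᴿ toℕ j *ₗ x)
             (≡.sym (toℕ-fromℕ< 1<N)) (λ σx≈ψx → ≈ᴹ-trans σx≈ψx (*ₗ-congʳ ψ≈ζʲ)) (eigen (fromℕ< 1<N)))
    where
    1<N : 1 < N
    1<N = *-monoʳ-≤ 2 (m^n>0 2 n)
    ψ≈ζʲ : pow R ζ (toℕ j * 1) ≈ᴿ ζ ^ᴿ toℕ j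
    ψ≈ζʲ = R.reflexive (≡.trans (pow≡^ᴿ ζ (toℕ j * 1)) (≡.cong (ζ ^ᴿ_) (*-identityʳ (toℕ j))))

  fix-twist₀⇒InEigen : ∀ j {x} → Fix (twist 0 (toℕ j)) x → InEigen R Z A j x
  fix-twist₀⇒InEigen j {x} fixed k =
    ≈ᴹ-trans (σ-eigen⇒iter-eigen (fix-twist₀⇒σ-eigen (toℕ j) fixed) (toℕ k))
             (*ₗ-congʳ (R.trans (^-assocʳ ζ (toℕ j) (toℕ k)) (R.reflexive (≡.sym (pow≡^ᴿ ζ (toℕ j * toℕ k))))))

  ζ^[e[N∸l]]≈ω^[el] : ∀ e l → l ≤ N → pow R ζ (e * (N ∸ l)) ≈ᴿ ω ^ᴿ (e * l)
  ζ^[e[N∸l]]≈ω^[el] e l l≤N = inverse-unique {x = ζ ^ᴿ (e * l)} (begin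
    pow R ζ (e * (N ∸ l)) *ᴿ ζ ^ᴿ (e * l)   ≡⟨ ≡.cong (_*ᴿ ζ ^ᴿ (e * l)) (pow≡^ᴿ ζ (e * (N ∸ l))) ⟩
    ζ ^ᴿ (e * (N ∸ l)) *ᴿ ζ ^ᴿ (e * l)      ≈⟨ ^-homo-* ζ (e * (N ∸ l)) (e * l) ⟨
    ζ ^ᴿ (e * (N ∸ l) + e * l)              ≡⟨ ≡.cong (ζ ^ᴿ_) exponent ⟩
    ζ ^ᴿ (N * e)                            ≈⟨ ^-assocʳ ζ N e ⟨
    (ζ ^ᴿ N) ^ᴿ e                           ≈⟨ ^-congˡ e ζ^N≈1 ⟩
    1# ^ᴿ e                                 ≈⟨ 1^ᴿ≈1 e ⟩
    1#                                      ∎)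
    (R.trans (R.*-comm _ _) (ζ^k*ω^k≈1 (e * l)))
    where
    open ≈ᴿ-Reasoning
    exponent : e * (N ∸ l) + e * l ≡ N * e
    exponent = ≡.trans (≡.sym (*-distribˡ-+ e (N ∸ l) l)) (≡.trans (≡.cong (e *_) (m∸n+n≡m l≤N)) (*-comm e N))

  ψ⁻¹-summand≈iter-twist₀ : ∀ j k y → ψ⁻¹ R Z A j k *ₗ act k y ≈ᴹ iter (toℕ k) (twist 0 (toℕ j)) y
  ψ⁻¹-summand≈iter-twist₀ j k y = ≈ᴹ-sym (begin
    iter l (twist 0 e) y
      ≈⟨ iter-twist 0 e l y ⟩
    ω ^ᴿ (e * 1 * l) *ₗ iter (l * 1) σ y
      ≡⟨ ≡.cong₂ (λ i i′ → ω ^ᴿ (i * l) *ₗ iter i′ σ y) (*-identityʳ e) (*-identityʳ l) ⟩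
    ω ^ᴿ (e * l) *ₗ iter l σ y
      ≈⟨ *ₗ-congʳ (ζ^[e[N∸l]]≈ω^[el] e l (<⇒≤ (toℕ<n k))) ⟨
    ψ⁻¹ R Z A j k *ₗ act k y
      ∎)
    where
    open ≈-Reasoning
    e = toℕ j
    l = toℕ k

  ε≈norm : ∀ j y → ε R Z A j y ≈ᴹ norm N (twist 0 (toℕ j)) y
  ε≈norm j y = from N (λ i → i) 0 (λ _ → refl)
    where
    T = twist 0 (toℕ j)
    from : ∀ k (φ : Fin k → Fin N) a → (∀ i → toℕ (φ i) ≡ a + toℕ i) →
           foldr (λ k acc → (ψ⁻¹ R Z A j k *ₗ act k y) +ᴹ acc) 0ᴹ (tabulate φ) ≈ᴹ norm k T (iter a T y)
    from zero    φ a φ≡a+ = ≈ᴹ-refl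
    from (suc k) φ a φ≡a+ = +ᴹ-cong
      (≈ᴹ-trans (ψ⁻¹-summand≈iter-twist₀ j (φ Fin.zero) y)
                (≈ᴹ-reflexive (≡.cong (λ i → iter i T y) (≡.trans (φ≡a+ Fin.zero) (+-identityʳ a)))))
      (from k (φ ∘ Fin.suc) (suc a) (λ i → ≡.trans (φ≡a+ (Fin.suc i)) (+-suc a (toℕ i))))

  #Fix : ℕ → ℕ → ℕ
  #Fix b e = count (fix? (twist b e))

  cardM≡#Fix : cardM R Z A F ≡ #Fix (suc n) 0
  cardM≡#Fix =
    ≡.sym (count-universal (fix? (twist (suc n) 0)) (λ x → ≈ᴹ-trans (*ₗ-identityˡ _) (σ-order x)))

  prodEigen≡∏ : prodEigen R Z A F ≡ ∏[ t < N ] #Fix 0 t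
  prodEigen≡∏ = product-allFin N _ (#Fix 0) (λ j → ≡.trans (length-filter≡∑ (inEigen? R Z A F j) elems)
    (count-cong (inEigen? R Z A F j) (fix? (twist 0 (toℕ j))) (InEigen⇒fix-twist₀ j) (fix-twist₀⇒InEigen j)))

  module WithPlusCondition (plus : PlusCondition R Z A) where

    Ĥ⁰-vanishes-τ : Ĥ⁰-vanishes 2 τ
    Ĥ⁰-vanishes-τ x τx≈x =
      let (y , x≈y+τy) = proj₁ (plus x) τx≈x
      in  y , ≈ᴹ-trans x≈y+τy (+ᴹ-congˡ (≈ᴹ-sym (+ᴹ-identityʳ (τ y))))

    -- twist n e = (-1)ᵉ τ, and Ĥ⁰ for an involution passes to its negative.
    Ĥ⁰-vanishes-twist-top : ∀ e → Ĥ⁰-vanishes 2 (twist n e)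
    Ĥ⁰-vanishes-twist-top zero    = Ĥ⁰-vanishes-cong 2 (iter-isEndo h σ-isEndo)
      (λ x → ≈ᴹ-sym (*ₗ-identityˡ (τ x))) Ĥ⁰-vanishes-τ
    Ĥ⁰-vanishes-twist-top (suc e) = Ĥ⁰-vanishes-cong 2 (-ᴹ-isEndo (twist-isEndo n e)) (λ x → ≈ᴹ-sym (shift x))
      (Ĥ⁰-vanishes-neg (twist-isEndo n e) (twist-order n 1 (+-comm n 1) e) (Ĥ⁰-vanishes-twist-top e))
      where
      shift : ∀ x → twist n (suc e) x ≈ᴹ -ᴹ twist n e x
      shift x = ≈ᴹ-trans (≈ᴹ-reflexive (≡.cong (λ i → twist n i x) (+-comm 1 e)))
                         (twist-shift n 0 (+-comm n 1) e x)

    Ĥ⁰-vanishes-twist : ∀ d b → b + d ≡ n → ∀ e → Ĥ⁰-vanishes (2 ^ suc d) (twist b e)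
    Ĥ⁰-vanishes-twist zero    b b+0≡n e =
      ≡.subst (λ b′ → Ĥ⁰-vanishes 2 (twist b′ e)) (≡.trans (≡.sym b+0≡n) (+-identityʳ b))
              (Ĥ⁰-vanishes-twist-top e)
    Ĥ⁰-vanishes-twist (suc d) b b+1+d≡n e = ≡.subst (λ i → Ĥ⁰-vanishes i T) (≡.sym 2^[2+d]≡4k)
                                              (Ĥ⁰-vanishes-of-square (twist-isEndo b e) k Ĥ⁰T² Ĥ⁻¹T²)
      where
      k = 2 ^ d
      T = twist b e
      T²-endo = ∘-isEndo (twist-isEndo b e) (twist-isEndo b e)
      2^[1+d]≡2k = 2^[1+d]≡2^d+2^d d
      2^[2+d]≡4k : 2 ^ suc (suc d) ≡ (k + k) + (k + k)
      2^[2+d]≡4k = ≡.trans (2^[1+d]≡2^d+2^d (suc d)) (≡.cong₂ _+_ 2^[1+d]≡2k 2^[1+d]≡2k)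
      Ĥ⁰T² : Ĥ⁰-vanishes (k + k) (T ∘ T)
      Ĥ⁰T² = Ĥ⁰-vanishes-cong (k + k) (twist-isEndo (suc b) e) (λ x → ≈ᴹ-sym (twist-square b e x))
               (≡.subst (λ i → Ĥ⁰-vanishes i (twist (suc b) e)) 2^[1+d]≡2k
                        (Ĥ⁰-vanishes-twist d (suc b) (≡.trans (≡.sym (+-suc b d)) b+1+d≡n) e))
      T²ᵏ⁺ᵏ≈id : ∀ x → iter (k + k) (T ∘ T) x ≈ᴹ x
      T²ᵏ⁺ᵏ≈id x = ≈ᴹ-trans (iter-cong (k + k) T²-endo (twist-square b e) x)
        (≡.subst (λ i → iter i (twist (suc b) e) x ≈ᴹ x) 2^[1+d]≡2k
                 (twist-order (suc b) (suc d) (≡.cong suc b+1+d≡n) e x))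
      Ĥ⁻¹T² : Ĥ⁻¹-vanishes (k + k) (T ∘ T)
      Ĥ⁻¹T² = Ĥ⁰-vanishes⇒Ĥ⁻¹-vanishes T²-endo {k + k} T²ᵏ⁺ᵏ≈id Ĥ⁰T²

    #Fix-split : ∀ b c → b + c ≡ n → ∀ e → #Fix (suc b) e ≡ #Fix b e * #Fix b (e + 2 ^ c)
    #Fix-split b c b+c≡n e = ≡.trans
      (count-cong (fix? (twist (suc b) e)) (fix? (twist b e ∘ twist b e))
                  (≈ᴹ-trans (twist-square b e _)) (≈ᴹ-trans (≈ᴹ-sym (twist-square b e _))))
      (count-fix-square (twist-isEndo b e) (2 ^ c) order (twist-shift b c b+1+c≡1+n e) Ĥ⁰-shifted)
      where
      b+1+c≡1+n = ≡.trans (+-suc b c) (≡.cong suc b+c≡n)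
      order : ∀ x → iter (2 ^ c + 2 ^ c) (twist b e) x ≈ᴹ x
      order x = ≡.subst (λ i → iter i (twist b e) x ≈ᴹ x) (2^[1+d]≡2^d+2^d c)
                        (twist-order b (suc c) b+1+c≡1+n e x)
      Ĥ⁰-shifted : Ĥ⁰-vanishes (2 ^ c + 2 ^ c) (twist b (e + 2 ^ c))
      Ĥ⁰-shifted = ≡.subst (λ i → Ĥ⁰-vanishes i (twist b (e + 2 ^ c))) (2^[1+d]≡2^d+2^d c)
                           (Ĥ⁰-vanishes-twist c b b+c≡n (e + 2 ^ c))

    #Fix-product : ∀ b c → b + c ≡ suc n → ∀ r → #Fix b r ≡ ∏[ t < 2 ^ b ] #Fix 0 (r + t * 2 ^ c)
    #Fix-product zero    c _ r = ≡.sym (≡.trans (*-identityʳ _) (≡.cong (#Fix 0) (+-identityʳ r)))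
    #Fix-product (suc b) c 1+b+c≡1+n r = begin
      #Fix (suc b) r
        ≡⟨ #Fix-split b c (suc-injective 1+b+c≡1+n) r ⟩
      #Fix b r * #Fix b (r + 2 ^ c)
        ≡⟨ ≡.cong₂ _*_ (#Fix-product b (suc c) b+1+c≡1+n r) (#Fix-product b (suc c) b+1+c≡1+n (r + 2 ^ c)) ⟩
      ∏[ t < 2 ^ b ] #Fix 0 (r + t * 2 ^ suc c) * ∏[ t < 2 ^ b ] #Fix 0 (r + 2 ^ c + t * 2 ^ suc c)
        ≡⟨ ≡.cong₂ _*_ (∏-cong (2 ^ b) (λ t → ≡.cong (#Fix 0) (even r t (2 ^ c))))
                       (∏-cong (2 ^ b) (λ t → ≡.cong (#Fix 0) (odd r t (2 ^ c)))) ⟩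
      ∏[ t < 2 ^ b ] g (t + t) * ∏[ t < 2 ^ b ] g (suc (t + t))
        ≡⟨ ∏-even-odd (2 ^ b) g ⟨
      ∏[ t < 2 ^ b + 2 ^ b ] g t
        ≡⟨ ≡.cong (λ i → ∏< i g) (2^[1+d]≡2^d+2^d b) ⟨
      ∏[ t < 2 ^ suc b ] g t ∎
      where
      open ≡.≡-Reasoning
      open +-*-Solver
      g : ℕ → ℕ
      g t = #Fix 0 (r + t * 2 ^ c)
      b+1+c≡1+n = ≡.trans (+-suc b c) 1+b+c≡1+n
      even : ∀ r t x → r + t * (x + (x + 0)) ≡ r + (t + t) * x
      even = solve 3 (λ r t x → r :+ t :* (x :+ (x :+ con 0)) := r :+ (t :+ t) :* x) refl
      odd : ∀ r t x → r + x + t * (x + (x + 0)) ≡ r + (x + (t + t) * x)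
      odd = solve 3 (λ r t x → r :+ x :+ t :* (x :+ (x :+ con 0)) := r :+ (x :+ (t :+ t) :* x)) refl

    InImage-ε⇔fix-twist₀ : ∀ j {x} → (InImage (ε R Z A j) x → Fix (twist 0 (toℕ j)) x)
                                   × (Fix (twist 0 (toℕ j)) x → InImage (ε R Z A j) x)
    InImage-ε⇔fix-twist₀ j {x} = image⇒fixed , fixed⇒image
      where
      T = twist 0 (toℕ j)
      T-endo = twist-isEndo 0 (toℕ j)
      image⇒fixed : InImage (ε R Z A j) x → Fix T x
      image⇒fixed x∈im = let (y , x≈εy) = Any.satisfied x∈im in
        fix-resp T-endo (≈ᴹ-sym (≈ᴹ-trans x≈εy (ε≈norm j y)))
                        (norm-fixedBy T-endo N (twist-order 0 (suc n) refl (toℕ j)) y)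
      fixed⇒image : Fix T x → InImage (ε R Z A j) x
      fixed⇒image fixed = let (y , x≈Ny) = Ĥ⁰-vanishes-twist n 0 refl (toℕ j) x fixed in
        Any.map (λ y≈y′ → ≈ᴹ-trans x≈Ny (≈ᴹ-trans (cong (norm-isEndo N T-endo) y≈y′) (≈ᴹ-sym (ε≈norm j _))))
                (complete y)

    prodEpsImage≡∏ : prodEpsImage R Z A F ≡ ∏[ t < N ] #Fix 0 t
    prodEpsImage≡∏ = product-allFin N _ (#Fix 0) (λ j → ≡.trans (length-filter≡∑ (inImage? (ε R Z A j)) elems)
      (count-cong (inImage? (ε R Z A j)) (fix? (twist 0 (toℕ j)))
                  (proj₁ (InImage-ε⇔fix-twist₀ j)) (proj₂ (InImage-ε⇔fix-twist₀ j))))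

    cardM≡∏ : cardM R Z A F ≡ ∏[ t < N ] #Fix 0 t
    cardM≡∏ = ≡.trans cardM≡#Fix (≡.trans (#Fix-product (suc n) 0 (+-identityʳ (suc n)) 0)
                                           (∏-cong N (λ t → ≡.cong (#Fix 0) (*-identityʳ t))))

corollary4p11 : ∀ {r ℓr m ℓm : Level} (R : CommutativeRing r ℓr) (n : ℕ) → 1 ≤ n →
    (Z : ZetaHom R n) (A : RGModule R n m ℓm) (F : FiniteRGModule R A) →
    PlusCondition R Z A →
    (cardM R Z A F ≡ prodEigen R Z A F) × (prodEigen R Z A F ≡ prodEpsImage R Z A F)
corollary4p11 R zero    () Z A F plus
corollary4p11 R (suc n) _  Z A F plus =
  ≡.trans cardM≡∏ (≡.sym prodEigen≡∏) , ≡.trans prodEigen≡∏ (≡.sym prodEpsImage≡∏)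
  where open TwistedAction R n Z A F
        open WithPlusCondition plus
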